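{- Let $a,b\ge2$ and $c,d\ge0$ be integers and let $\pi=123[\iota_c,21[\iota_a,\iota_b],\iota_d]$, i.e. $\pi=1\,2\cdots c\,(c+b+1)(c+b+2)\cdots(c+b+a)\,(c+1)(c+2)\cdots(c+b)\,(c+a+b+1)\cdots(c+a+b+d)\in\mathfrak S_{a+b+c+d}$. Then $\operatorname{diam}(G_{\pi})=\frac12|L_2(\pi)|$.
   Context: $\iota_k=12\cdots k$ denotes the identity of $\mathfrak S_k$ ($\iota_0$ empty). For $\alpha\in\mathfrak S_a,\beta\in\mathfrak S_b$, $21[\alpha,\beta]=(\alpha_1+b)\cdots(\alpha_a+b)\beta_1\cdots\beta_b$. For $\pi\in\mathfrak S_n$, an inversion is a pair $(i,j)$ with $i<j$, $\pi_i>\pi_j$; $I_2(\pi)$ is the set of unordered pairs of disjoint inversions, $I_3(\pi)$ the set of triples of inversions $((i,j),(i,k),(j,k))$ with $i<j<k$ (occurrences of $321$), and $|L_2(\pi)|=|I_2(\pi)|+|I_3(\pi)|$. $R(\pi)$ is the set of reduced words of $\pi$ (minimal-length words $r_1\cdots r_\ell$ in $[n-1]$ with $\pi=s_{r_1}\cdots s_{r_\ell}$, $s_i=(i,i+1)$); $G_\pi$ is the graph on $R(\pi)$ whose edges join words related by one commutation move (exchange adjacent $jk$, $|j-k|>1$) or one long braid move (consecutive $j(j+1)j\leftrightarrow(j+1)j(j+1)$). Diameter = maximum distance between two vertices. -}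

module Defs where

open import Data.Nat using (ℕ; zero; suc; _+_; _*_; _∸_; _≤_; _<_; _≤ᵇ_; _<ᵇ_; _≡ᵇ_)
open import Data.Bool using (Bool; true; false; if_then_else_; _∧_; not)
open import Data.List using (List; []; _∷_; _++_; length; map; concatMap; upTo; filterᵇ)
open import Data.List.Relation.Unary.All using (All)
open import Data.Product using (_×_; _,_; Σ; ∃; ∃-syntax)
open import Data.Sum using (_⊎_)
open import Relation.Binary.PropositionalEquality using (_≡_)

-- Permutations in one-line notation, as functions on positions 1..n
-- (identity outside 1..n).

s : ℕ → ℕ → ℕ
s r i = if i ≡ᵇ r then suc r else (if i ≡ᵇ suc r then r else i)

prod : List ℕ → ℕ → ℕ
prod [] i = i
prod (r ∷ w) i = s r (prod w i)

IsWord : ℕ → List ℕ → Set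
IsWord n w = All (λ r → 1 ≤ r × r < n) w

Represents : ℕ → (ℕ → ℕ) → List ℕ → Set
Represents n f w = IsWord n w × (∀ i → 1 ≤ i → i ≤ n → prod w i ≡ f i)

Reduced : ℕ → (ℕ → ℕ) → List ℕ → Set
Reduced n f w = Represents n f w × (∀ v → Represents n f v → length w ≤ length v)

-- Edges of G_π : one commutation move or one long braid move

data Move : List ℕ → List ℕ → Set where
  commute : ∀ p q j k → (suc j < k ⊎ suc k < j) →
            Move (p ++ j ∷ k ∷ q) (p ++ k ∷ j ∷ q)
  braid₁  : ∀ p q j →
            Move (p ++ j ∷ suc j ∷ j ∷ q) (p ++ suc j ∷ j ∷ suc j ∷ q)
  braid₂  : ∀ p q j →
            Move (p ++ suc j ∷ j ∷ suc j ∷ q) (p ++ j ∷ suc j ∷ j ∷ q)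

data Walk (n : ℕ) (f : ℕ → ℕ) : List ℕ → List ℕ → ℕ → Set where
  here : ∀ {u} → Walk n f u u 0
  step : ∀ {u v w k} → Move u v → Reduced n f v → Walk n f v w k →
         Walk n f u w (suc k)

IsDiameter : ℕ → (ℕ → ℕ) → ℕ → Set
IsDiameter n f D =
  (∀ u v → Reduced n f u → Reduced n f v →
     ∃[ k ] (k ≤ D × Walk n f u v k))
  × (∃[ u ] ∃[ v ] (Reduced n f u × Reduced n f v ×
       (∀ k → Walk n f u v k → D ≤ k)))

positions : ℕ → List ℕ
positions n = map suc (upTo n)

inversions : ℕ → (ℕ → ℕ) → List (ℕ × ℕ)
inversions n f =
  concatMap (λ i → concatMap (λ j →
    if (i <ᵇ j) ∧ (f j <ᵇ f i) then (i , j) ∷ [] else [])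
    (positions n)) (positions n)

disjointᵇ : ℕ × ℕ → ℕ × ℕ → Bool
disjointᵇ (i , j) (k , l) =
  not (i ≡ᵇ k) ∧ not (i ≡ᵇ l) ∧ not (j ≡ᵇ k) ∧ not (j ≡ᵇ l)

disjointPairs : List (ℕ × ℕ) → ℕ
disjointPairs [] = 0
disjointPairs (p ∷ ps) = length (filterᵇ (disjointᵇ p) ps) + disjointPairs ps

I2 : ℕ → (ℕ → ℕ) → ℕ
I2 n f = disjointPairs (inversions n f)

I3 : ℕ → (ℕ → ℕ) → ℕ
I3 n f = length (concatMap (λ i → concatMap (λ j → concatMap (λ k →
    if (i <ᵇ j) ∧ (j <ᵇ k) ∧ (f j <ᵇ f i) ∧ (f k <ᵇ f j) then (i , j , k) ∷ [] else [])
    (positions n)) (positions n)) (positions n))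

L2 : ℕ → (ℕ → ℕ) → ℕ
L2 n f = I2 n f + I3 n f

piABCD : ℕ → ℕ → ℕ → ℕ → ℕ → ℕ
piABCD a b c d i =
  if i ≤ᵇ c then i
  else if i ≤ᵇ c + a then i + b
  else if i ≤ᵇ c + a + b then i ∸ a
  else i

module Submission where

-- Reading a reduced word of π from the left removes the cells of the a × b rectangle one at a
-- time: a state is a shape h (the column heights still to be removed, weakly increasing), and
-- the next letter must be c + k + h k − 1 for a corner k, i.e. a column with h (k − 1) < h k.
-- Reduced words are thus standard fillings of the rectangle, recorded by their column sequences κ.
-- No braid move ever applies to such words, and a commutation move swaps two adjacent entries of
-- κ, changing its number of inversions by at most one; the column-by-column and the
-- level-by-level fillings differ by C(a,2)·C(b,2) inversions.  Conversely, any filling is turned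
-- into any other by bubbling the first corner of the target to the front; the potential
-- Σ_{i<j} cost (h i) (h j) pays for all these commutations and equals C(a,2)·C(b,2) on the full
-- rectangle.  Finally, the inversions of π are exactly the pairs (A-position, B-position), so π
-- avoids 321 and |I₂(π)| = C(a,2)·b(b − 1).

open import Defs
open import Data.Nat
  using (ℕ; zero; suc; _+_; _*_; _∸_; _≤_; _<_; _≤ᵇ_; _<ᵇ_; _≡ᵇ_; z≤n; s≤s; _≟_; _≤?_; _<?_)
open import Data.Nat.Properties
open import Data.Nat.Tactic.RingSolver using (solve-∀)
open import Data.Bool using (Bool; true; false; if_then_else_; _∧_; not)
open import Data.List using (List; []; _∷_; _++_; length; map; concatMap; filterᵇ; replicate; applyUpTo)
open import Data.List.Properties using (concatMap-++; ++-identityʳ; map-applyUpTo; length-++; filter-++)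
open import Data.List.Relation.Unary.All as All using (All; []; _∷_)
open import Data.List.Relation.Unary.All.Properties using (++⁺; replicate⁺)
open import Data.Product using (_×_; _,_; ∃-syntax; proj₁; proj₂)
open import Data.Sum using (_⊎_; inj₁; inj₂)
open import Data.Empty using (⊥; ⊥-elim)
open import Function using (id; _∘_)
open import Relation.Nullary using (¬_; yes; no)
open import Data.Bool.Properties using (T?)
open import Relation.Binary using (tri<; tri≈; tri>)
open import Relation.Binary.PropositionalEquality

≡ᵇ-refl : ∀ m → (m ≡ᵇ m) ≡ true
≡ᵇ-refl zero = refl
≡ᵇ-refl (suc m) = ≡ᵇ-refl m

≢⇒≡ᵇ-false : ∀ m n → m ≢ n → (m ≡ᵇ n) ≡ false
≢⇒≡ᵇ-false zero zero ne = ⊥-elim (ne refl)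
≢⇒≡ᵇ-false zero (suc n) ne = refl
≢⇒≡ᵇ-false (suc m) zero ne = refl
≢⇒≡ᵇ-false (suc m) (suc n) ne = ≢⇒≡ᵇ-false m n (λ e → ne (cong suc e))

<⇒<ᵇ-true : ∀ m n → m < n → (m <ᵇ n) ≡ true
<⇒<ᵇ-true zero (suc n) p = refl
<⇒<ᵇ-true (suc m) (suc n) (s≤s p) = <⇒<ᵇ-true m n p

≮⇒<ᵇ-false : ∀ m n → ¬ m < n → (m <ᵇ n) ≡ false
≮⇒<ᵇ-false m zero p = refl
≮⇒<ᵇ-false zero (suc n) p = ⊥-elim (p (s≤s z≤n))
≮⇒<ᵇ-false (suc m) (suc n) p = ≮⇒<ᵇ-false m n (λ q → p (s≤s q))

≤⇒≤ᵇ-true : ∀ m n → m ≤ n → (m ≤ᵇ n) ≡ true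
≤⇒≤ᵇ-true zero n p = refl
≤⇒≤ᵇ-true (suc m) n p = <⇒<ᵇ-true m n p

≰⇒≤ᵇ-false : ∀ m n → ¬ m ≤ n → (m ≤ᵇ n) ≡ false
≰⇒≤ᵇ-false zero n p = ⊥-elim (p z≤n)
≰⇒≤ᵇ-false (suc m) n p = ≮⇒<ᵇ-false m n p

bit : Bool → ℕ
bit true = 1
bit false = 0

bit≤1 : ∀ b → bit b ≤ 1
bit≤1 true = s≤s z≤n
bit≤1 false = z≤n

bit-<ᵇ-cases : ∀ x m → (x < m × bit (x <ᵇ m) ≡ 1) ⊎ (¬ x < m × bit (x <ᵇ m) ≡ 0)
bit-<ᵇ-cases x m with x <? m
... | yes p rewrite <⇒<ᵇ-true x m p = inj₁ (p , refl)
... | no p rewrite ≮⇒<ᵇ-false x m p = inj₂ (p , refl)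

suc[n∸1]≡n : ∀ {n} → 1 ≤ n → suc (n ∸ 1) ≡ n
suc[n∸1]≡n = m+[n∸m]≡n

≤∸1⇒< : ∀ {x k} → 1 ≤ k → x ≤ k ∸ 1 → x < k
≤∸1⇒< {x} {suc k} _ le = s≤s le

sumTo : ℕ → (ℕ → ℕ) → ℕ
sumTo zero f = 0
sumTo (suc n) f = sumTo n f + f (suc n)

InRange : ℕ → ℕ → Set
InRange n i = 1 ≤ i × i ≤ n

InRange-suc : ∀ {n i} → InRange n i → InRange (suc n) i
InRange-suc (p , q) = p , m≤n⇒m≤1+n q

InRange-last : ∀ n → InRange (suc n) (suc n)
InRange-last n = s≤s z≤n , ≤-refl

sumTo-cong : ∀ n {f g : ℕ → ℕ} → (∀ i → InRange n i → f i ≡ g i) → sumTo n f ≡ sumTo n g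
sumTo-cong zero h = refl
sumTo-cong (suc n) h = cong₂ _+_ (sumTo-cong n (λ i ii → h i (InRange-suc ii))) (h (suc n) (InRange-last n))

sumTo-mono-≤ : ∀ n {f g : ℕ → ℕ} → (∀ i → InRange n i → f i ≤ g i) → sumTo n f ≤ sumTo n g
sumTo-mono-≤ zero h = z≤n
sumTo-mono-≤ (suc n) h = +-mono-≤ (sumTo-mono-≤ n (λ i ii → h i (InRange-suc ii))) (h (suc n) (InRange-last n))

sumTo-mono-< : ∀ n {f g : ℕ → ℕ} → (∀ i → InRange n i → f i ≤ g i) →
               ∀ i₀ → InRange n i₀ → f i₀ < g i₀ → sumTo n f < sumTo n g
sumTo-mono-< zero h i₀ (p , q) lt = ⊥-elim (1+n≰n (≤-trans p q))
sumTo-mono-< (suc n) h i₀ (p , q) lt with i₀ ≟ suc n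
... | yes refl = +-mono-≤-< (sumTo-mono-≤ n (λ i ii → h i (InRange-suc ii))) lt
... | no ne = +-mono-<-≤ (sumTo-mono-< n (λ i ii → h i (InRange-suc ii)) i₀ (p , ≤-pred (≤∧≢⇒< q ne)) lt)
                         (h (suc n) (InRange-last n))

sumTo-<⇒∃ : ∀ n {f g : ℕ → ℕ} → sumTo n f < sumTo n g → ∃[ i ] (InRange n i × f i < g i)
sumTo-<⇒∃ (suc n) {f} {g} lt with f (suc n) <? g (suc n)
... | yes p = suc n , InRange-last n , p
... | no np with sumTo-<⇒∃ n (+-cancelʳ-< (f (suc n)) (sumTo n f) (sumTo n g)
                               (≤-trans lt (+-monoʳ-≤ (sumTo n g) (≮⇒≥ np))))
... | i , ii , r = i , InRange-suc ii , r

sumTo-distrib-+ : ∀ n (f g : ℕ → ℕ) → sumTo n (λ i → f i + g i) ≡ sumTo n f + sumTo n g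
sumTo-distrib-+ zero f g = refl
sumTo-distrib-+ (suc n) f g rewrite sumTo-distrib-+ n f g = interchange (sumTo n f) (sumTo n g) (f (suc n)) (g (suc n))
  where interchange : ∀ x y z w → x + y + (z + w) ≡ x + z + (y + w)
        interchange = solve-∀

sumTo²-distrib-+ : ∀ n (F G : ℕ → ℕ → ℕ) →
  sumTo n (λ p → sumTo n (λ q → F p q + G p q)) ≡ sumTo n (λ p → sumTo n (F p)) + sumTo n (λ p → sumTo n (G p))
sumTo²-distrib-+ n F G = trans (sumTo-cong n (λ p _ → sumTo-distrib-+ n (F p) (G p))) (sumTo-distrib-+ n _ _)

sumTo-zero : ∀ n {f : ℕ → ℕ} → (∀ i → InRange n i → f i ≡ 0) → sumTo n f ≡ 0
sumTo-zero zero h = refl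
sumTo-zero (suc n) h rewrite sumTo-zero n (λ i ii → h i (InRange-suc ii)) | h (suc n) (InRange-last n) = refl

sumTo-ones : ∀ k {f : ℕ → ℕ} → (∀ j → InRange k j → f j ≡ 1) → sumTo k f ≡ k
sumTo-ones zero h = refl
sumTo-ones (suc k) h =
  trans (cong₂ _+_ (sumTo-ones k (λ j jj → h j (InRange-suc jj))) (h (suc k) (InRange-last k))) (+-comm k 1)

sumTo-bits-≤ : ∀ m {f : ℕ → ℕ} → (∀ j → f j ≤ 1) → sumTo m f ≤ m
sumTo-bits-≤ zero b = z≤n
sumTo-bits-≤ (suc m) b = ≤-trans (+-mono-≤ (sumTo-bits-≤ m b) (b (suc m))) (≤-reflexive (+-comm m 1))

sumTo-atMostOne : ∀ n {f : ℕ → ℕ} → (∀ i → f i ≤ 1) →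
                  (∀ i j → InRange n i → InRange n j → 1 ≤ f i → 1 ≤ f j → i ≡ j) → sumTo n f ≤ 1
sumTo-atMostOne zero b u = z≤n
sumTo-atMostOne (suc n) {f} b u with f (suc n) in e
... | zero rewrite +-identityʳ (sumTo n f) =
  sumTo-atMostOne n b (λ i j ii jj → u i j (InRange-suc ii) (InRange-suc jj))
... | suc k = subst (λ t → t + suc k ≤ 1) (sym rest) (subst (_≤ 1) e (b (suc n)))
  where
  rest : sumTo n f ≡ 0
  rest = sumTo-zero n zero-before
    where
    zero-before : ∀ i → InRange n i → f i ≡ 0
    zero-before i ii with f i in e'
    ... | zero = refl
    ... | suc _ = ⊥-elim (<-irrefl (u i (suc n) (InRange-suc ii) (InRange-last n)
                                       (subst (1 ≤_) (sym e') (s≤s z≤n)) (subst (1 ≤_) (sym e) (s≤s z≤n)))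
                                    (s≤s (proj₂ ii)))

sumTo-prefix-≤ : ∀ k m {f : ℕ → ℕ} → k ≤ m → sumTo k f ≤ sumTo m f
sumTo-prefix-≤ k zero z≤n = z≤n
sumTo-prefix-≤ k (suc m) km with k ≟ suc m
... | yes refl = ≤-refl
... | no ne = ≤-trans (sumTo-prefix-≤ k m (≤-pred (≤∧≢⇒< km ne))) (m≤m+n _ _)

sumTo-trailingZeros : ∀ k m {f : ℕ → ℕ} → (∀ j → k < j → j ≤ m → f j ≡ 0) → k ≤ m →
                      sumTo m f ≡ sumTo k f
sumTo-trailingZeros k zero z z≤n = refl
sumTo-trailingZeros k (suc m) z km with k ≟ suc m
... | yes refl = refl
... | no ne = trans (cong₂ _+_ (sumTo-trailingZeros k m (λ j kj jm → z j kj (m≤n⇒m≤1+n jm)) k≤m)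
                               (z (suc m) (s≤s k≤m) ≤-refl))
                    (+-identityʳ _)
  where k≤m : k ≤ m
        k≤m = ≤-pred (≤∧≢⇒< km ne)

sumTo-* : ∀ n f k → sumTo n (λ i → f i * k) ≡ sumTo n f * k
sumTo-* zero f k = refl
sumTo-* (suc n) f k rewrite sumTo-* n f k = sym (*-distribʳ-+ k (sumTo n f) (f (suc n)))

sumTo-swap : ∀ n m (f : ℕ → ℕ → ℕ) →
             sumTo n (λ i → sumTo m (f i)) ≡ sumTo m (λ j → sumTo n (λ i → f i j))
sumTo-swap zero m f = sym (sumTo-zero m (λ _ _ → refl))
sumTo-swap (suc n) m f rewrite sumTo-swap n m f = sym (sumTo-distrib-+ m (λ j → sumTo n (λ i → f i j)) (f (suc n)))

s-left : ∀ r → s r r ≡ suc r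
s-left r rewrite ≡ᵇ-refl r = refl

s-right : ∀ r → s r (suc r) ≡ r
s-right r rewrite ≢⇒≡ᵇ-false (suc r) r (>⇒≢ (n<1+n r)) | ≡ᵇ-refl r = refl

s-fixed : ∀ r i → i ≢ r → i ≢ suc r → s r i ≡ i
s-fixed r i n1 n2 rewrite ≢⇒≡ᵇ-false i r n1 | ≢⇒≡ᵇ-false i (suc r) n2 = refl

s-fixes-below : ∀ r x → suc (suc x) ≤ suc r → s r x ≡ x
s-fixes-below r x le = s-fixed r x (<⇒≢ (≤-pred le)) (<⇒≢ (≤-trans (n≤1+n _) le))

s-fixes-above : ∀ r x → suc r < x → s r x ≡ x
s-fixes-above r x lt = s-fixed r x (>⇒≢ (≤-trans (n≤1+n _) lt)) (>⇒≢ lt)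

s-involutive : ∀ r i → s r (s r i) ≡ i
s-involutive r i with i ≟ r
... | yes refl rewrite s-left r = s-right r
... | no n1 with i ≟ suc r
... | yes refl rewrite s-right r = s-left r
... | no n2 rewrite s-fixed r i n1 n2 = s-fixed r i n1 n2

s-injective : ∀ r {x y} → s r x ≡ s r y → x ≡ y
s-injective r {x} {y} e = trans (sym (s-involutive r x)) (trans (cong (s r) e) (s-involutive r y))

s-preservesOrder : ∀ r x y → y < x → ¬ (x ≡ suc r × y ≡ r) → s r y < s r x
s-preservesOrder r x y lt ex with x ≟ r
... | yes refl rewrite s-left x | s-fixed x y (<⇒≢ lt) (<⇒≢ (m<n⇒m<1+n lt)) = m<n⇒m<1+n lt
... | no m1 with x ≟ suc r
... | yes refl rewrite s-right r with y ≟ r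
...   | yes refl = ⊥-elim (ex (refl , refl))
...   | no ne rewrite s-fixed r y ne (<⇒≢ lt) = ≤∧≢⇒< (≤-pred lt) ne
s-preservesOrder r x y lt ex | no m1 | no m2 rewrite s-fixed r x m1 m2 with y ≟ r
... | yes refl rewrite s-left y = ≤∧≢⇒< lt (m2 ∘ sym)
... | no n1 with y ≟ suc r
... | yes refl rewrite s-right r = ≤-trans (n≤1+n _) lt
... | no n2 rewrite s-fixed r y n1 n2 = lt

prod-injective : ∀ w {x y} → prod w x ≡ prod w y → x ≡ y
prod-injective [] e = e
prod-injective (r ∷ w) e = prod-injective w (s-injective r e)

isInversion : (ℕ → ℕ) → ℕ → ℕ → ℕ
isInversion g p q = bit ((p <ᵇ q) ∧ (g q <ᵇ g p))

inv : ℕ → (ℕ → ℕ) → ℕ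
inv n g = sumTo n (λ p → sumTo n (isInversion g p))

isInversion-cases : ∀ g p q → (p < q × g q < g p × isInversion g p q ≡ 1)
                             ⊎ (¬ (p < q × g q < g p) × isInversion g p q ≡ 0)
isInversion-cases g p q with p <? q
... | no np rewrite ≮⇒<ᵇ-false p q np = inj₂ ((λ (a , _) → np a) , refl)
... | yes pq with g q <? g p
... | yes gg rewrite <⇒<ᵇ-true p q pq | <⇒<ᵇ-true (g q) (g p) gg = inj₁ (pq , gg , refl)
... | no ng rewrite <⇒<ᵇ-true p q pq | ≮⇒<ᵇ-false (g q) (g p) ng = inj₂ ((λ (_ , b) → ng b) , refl)

inv-cong : ∀ n g g' → (∀ i → InRange n i → g i ≡ g' i) → inv n g ≡ inv n g'
inv-cong n g g' h = sumTo-cong n (λ p ip → sumTo-cong n (λ q iq →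
  cong₂ (λ u v → bit ((p <ᵇ q) ∧ (v <ᵇ u))) (h p ip) (h q iq)))

inv-id : ∀ n g → (∀ i → InRange n i → g i ≡ i) → inv n g ≡ 0
inv-id n g h = trans (inv-cong n g id h) (sumTo-zero n (λ p _ → sumTo-zero n (λ q _ → noInversion p q)))
  where
  noInversion : ∀ p q → isInversion id p q ≡ 0
  noInversion p q with isInversion-cases id p q
  ... | inj₁ (a , b , _) = ⊥-elim (<-asym a b)
  ... | inj₂ (_ , e) = e

InjectiveOn : ℕ → (ℕ → ℕ) → Set
InjectiveOn n g = ∀ i j → InRange n i → InRange n j → g i ≡ g j → i ≡ j

isPair : (ℕ → ℕ) → ℕ → ℕ → ℕ → ℕ
isPair g r p q = bit ((g p ≡ᵇ suc r) ∧ (g q ≡ᵇ r))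

isPair-pos : ∀ g r p q → 1 ≤ isPair g r p q → g p ≡ suc r × g q ≡ r
isPair-pos g r p q h with g p ≟ suc r | g q ≟ r
... | yes e1 | yes e2 = e1 , e2
... | no e1 | _ rewrite ≢⇒≡ᵇ-false (g p) (suc r) e1 = ⊥-elim (1+n≰n h)
... | yes e1 | no e2 rewrite ≢⇒≡ᵇ-false (g q) r e2 | e1 | ≡ᵇ-refl r = ⊥-elim (1+n≰n h)

pairs≤1 : ∀ n g r → InjectiveOn n g → sumTo n (λ p → sumTo n (isPair g r p)) ≤ 1
pairs≤1 n g r inj = sumTo-atMostOne n row≤1 (λ p p' ip ip' hp hp' →
  inj p p' ip ip' (trans (rowHit p hp) (sym (rowHit p' hp'))))
  where
  row≤1 : ∀ p → sumTo n (isPair g r p) ≤ 1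
  row≤1 p = sumTo-atMostOne n (λ q → bit≤1 _) (λ q q' iq iq' hq hq' →
    inj q q' iq iq' (trans (proj₂ (isPair-pos g r p q hq)) (sym (proj₂ (isPair-pos g r p q' hq')))))
  rowHit : ∀ p → 1 ≤ sumTo n (isPair g r p) → g p ≡ suc r
  rowHit p h with sumTo-<⇒∃ n {λ _ → 0} (subst (_< sumTo n (isPair g r p)) (sym (sumTo-zero n (λ _ _ → refl))) h)
  ... | q , _ , lt = proj₁ (isPair-pos g r p q lt)

inv≤inv∘s+1 : ∀ n g r → InjectiveOn n g → inv n g ≤ inv n (s r ∘ g) + 1
inv≤inv∘s+1 n g r inj = begin
  inv n g
    ≤⟨ sumTo-mono-≤ n (λ p _ → sumTo-mono-≤ n (λ q _ → term p q)) ⟩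
  sumTo n (λ p → sumTo n (λ q → isInversion (s r ∘ g) p q + isPair g r p q))
    ≡⟨ sumTo²-distrib-+ n _ _ ⟩
  inv n (s r ∘ g) + sumTo n (λ p → sumTo n (isPair g r p))
    ≤⟨ +-monoʳ-≤ (inv n (s r ∘ g)) (pairs≤1 n g r inj) ⟩
  inv n (s r ∘ g) + 1
    ∎
  where
  open ≤-Reasoning
  term : ∀ p q → isInversion g p q ≤ isInversion (s r ∘ g) p q + isPair g r p q
  term p q with isInversion-cases g p q
  ... | inj₂ (_ , e) rewrite e = z≤n
  ... | inj₁ (pq , gg , e) rewrite e with g p ≟ suc r | g q ≟ r
  ... | yes e1 | yes e2 rewrite e1 | e2 | ≡ᵇ-refl r = m≤n+m 1 _
  ... | yes e1 | no e2 with isInversion-cases (s r ∘ g) p q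
  ...   | inj₁ (_ , _ , e3) rewrite e3 = s≤s z≤n
  ...   | inj₂ (ne , _) = ⊥-elim (ne (pq , s-preservesOrder r (g p) (g q) gg (e2 ∘ proj₂)))
  term p q | inj₁ (pq , gg , e) | no e1 | _ with isInversion-cases (s r ∘ g) p q
  ...   | inj₁ (_ , _ , e3) rewrite e3 = s≤s z≤n
  ...   | inj₂ (ne , _) = ⊥-elim (ne (pq , s-preservesOrder r (g p) (g q) gg (e1 ∘ proj₁)))

Far : ℕ → ℕ → Set
Far j k = suc j < k ⊎ suc k < j

inv-ascent : ∀ n g r p₀ q₀ → InjectiveOn n g → InRange n p₀ → InRange n q₀ → p₀ < q₀ →
             g p₀ ≡ r → g q₀ ≡ suc r → inv n g < inv n (s r ∘ g)
inv-ascent n g r p₀ q₀ inj ip₀ iq₀ lt e₀ e₁ =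
  sumTo-mono-< n (λ p ip → sumTo-mono-≤ n (λ q iq → term p q ip iq)) p₀ ip₀
    (sumTo-mono-< n (λ q iq → term p₀ q ip₀ iq) q₀ iq₀ created)
  where
  notTheSwappedPair : ∀ p q → InRange n p → InRange n q → p < q → ¬ (g p ≡ suc r × g q ≡ r)
  notTheSwappedPair p q ip iq pq (a , b) =
    <-asym lt (subst₂ _<_ (inj p q₀ ip iq₀ (trans a (sym e₁))) (inj q p₀ iq ip₀ (trans b (sym e₀))) pq)
  term : ∀ p q → InRange n p → InRange n q → isInversion g p q ≤ isInversion (s r ∘ g) p q
  term p q ip iq with isInversion-cases g p q
  ... | inj₂ (_ , e) rewrite e = z≤n
  ... | inj₁ (pq , gg , e) rewrite e with isInversion-cases (s r ∘ g) p q
  ...   | inj₁ (_ , _ , e') rewrite e' = ≤-refl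
  ...   | inj₂ (ne , _) = ⊥-elim (ne (pq , s-preservesOrder r (g p) (g q) gg (notTheSwappedPair p q ip iq pq)))
  created : isInversion g p₀ q₀ < isInversion (s r ∘ g) p₀ q₀
  created with isInversion-cases g p₀ q₀ | isInversion-cases (s r ∘ g) p₀ q₀
  ... | inj₁ (_ , gg , _) | _ = ⊥-elim (<-asym gg (subst₂ _<_ (sym e₀) (sym e₁) (n<1+n r)))
  ... | inj₂ (_ , e) | inj₁ (_ , _ , e') rewrite e | e' = s≤s z≤n
  ... | inj₂ _ | inj₂ (ne , _) = ⊥-elim (ne (lt , subst₂ _<_ (sym (trans (cong (s r) e₁) (s-right r)))
                                                             (sym (trans (cong (s r) e₀) (s-left r))) (n<1+n r)))

inv-descent : ∀ n g r → inv n (s r ∘ g) < inv n g →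
              ∃[ p ] ∃[ q ] (InRange n p × InRange n q × p < q × g p ≡ suc r × g q ≡ r)
inv-descent n g r lt with sumTo-<⇒∃ n lt
... | p , ip , lt₂ with sumTo-<⇒∃ n lt₂
... | q , iq , lt₃ with isInversion-cases g p q | isInversion-cases (s r ∘ g) p q
... | inj₂ (_ , e) | _ rewrite e = ⊥-elim (n≮0 lt₃)
... | inj₁ (_ , _ , e) | inj₁ (_ , _ , e') rewrite e | e' = ⊥-elim (1+n≰n lt₃)
... | inj₁ (pq , gg , _) | inj₂ (ne , _) with g p ≟ suc r | g q ≟ r
... | yes a | yes b = p , q , ip , iq , pq , a , b
... | no a | _ = ⊥-elim (ne (pq , s-preservesOrder r (g p) (g q) gg (a ∘ proj₁)))
... | yes _ | no b = ⊥-elim (ne (pq , s-preservesOrder r (g p) (g q) gg (b ∘ proj₂)))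

inv≤length : ∀ n v (f : ℕ → ℕ) → (∀ i → InRange n i → prod v i ≡ f i) → inv n f ≤ length v
inv≤length n [] f h = ≤-reflexive (inv-id n f (λ i ii → sym (h i ii)))
inv≤length n (r ∷ v) f h = begin
  inv n f               ≤⟨ inv≤inv∘s+1 n f r inj ⟩
  inv n (s r ∘ f) + 1   ≤⟨ +-monoˡ-≤ 1 (inv≤length n v (s r ∘ f) h') ⟩
  length v + 1          ≡⟨ +-comm (length v) 1 ⟩
  length (r ∷ v)        ∎
  where
  open ≤-Reasoning
  h' : ∀ i → InRange n i → prod v i ≡ s r (f i)
  h' i ii = trans (sym (s-involutive r (prod v i))) (cong (s r) (h i ii))
  inj : InjectiveOn n f
  inj i j ii ij e = prod-injective (r ∷ v) (trans (h i ii) (trans e (sym (h j ij))))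

choose2 : ℕ → ℕ
choose2 zero = 0
choose2 (suc q) = q + choose2 q

2*choose2 : ∀ b → 2 * choose2 b ≡ b * (b ∸ 1)
2*choose2 zero = refl
2*choose2 (suc b) = begin
  2 * (b + choose2 b)     ≡⟨ *-distribˡ-+ 2 b (choose2 b) ⟩
  2 * b + 2 * choose2 b   ≡⟨ cong (2 * b +_) (2*choose2 b) ⟩
  2 * b + b * (b ∸ 1)     ≡⟨ distribute b ⟩
  suc b * b               ∎
  where
  open ≡-Reasoning
  distribute : ∀ b → 2 * b + b * (b ∸ 1) ≡ suc b * b
  distribute zero = refl
  distribute (suc b) = ring b
    where ring : ∀ b → 2 * suc b + suc b * b ≡ suc (suc b) * suc b
          ring = solve-∀

interval : ℕ → ℕ → List ℕ
interval lo zero = []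
interval lo (suc l) = lo ∷ interval (suc lo) l

<-interval-end : ∀ lo l → lo < lo + suc l
<-interval-end lo l = subst (lo <_) (sym (+-suc lo l)) (s≤s (m≤m+n lo l))

All-interval : ∀ {P : ℕ → Set} lo l → (∀ x → lo ≤ x → x < lo + l → P x) → All P (interval lo l)
All-interval lo zero h = []
All-interval lo (suc l) h = h lo ≤-refl (<-interval-end lo l)
  ∷ All-interval (suc lo) l (λ x lx xl → h x (≤-trans (n≤1+n lo) lx) (subst (x <_) (sym (+-suc lo l)) xl))

length-interval : ∀ lo l → length (interval lo l) ≡ l
length-interval lo zero = refl
length-interval lo (suc l) = cong suc (length-interval (suc lo) l)

interval-++ : ∀ lo m k → interval lo (m + k) ≡ interval lo m ++ interval (lo + m) k
interval-++ lo zero k = cong (λ t → interval t k) (sym (+-identityʳ lo))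
interval-++ lo (suc m) k = cong (lo ∷_) (trans (interval-++ (suc lo) m k)
                                              (cong (λ t → interval (suc lo) m ++ interval t k) (sym (+-suc lo m))))

interval-snoc : ∀ lo l → interval lo (suc l) ≡ interval lo l ++ (lo + l) ∷ []
interval-snoc lo l = trans (cong (interval lo) (+-comm 1 l)) (interval-++ lo l 1)

applyUpTo-interval : ∀ n (f : ℕ → ℕ) lo → (∀ i → f i ≡ lo + i) → applyUpTo f n ≡ interval lo n
applyUpTo-interval zero f lo h = refl
applyUpTo-interval (suc n) f lo h = cong₂ _∷_ (trans (h 0) (+-identityʳ lo))
  (applyUpTo-interval n (f ∘ suc) (suc lo) (λ i → trans (h (suc i)) (+-suc lo i)))

positions-interval : ∀ n → positions n ≡ interval 1 n
positions-interval n = trans (map-applyUpTo id suc n) (applyUpTo-interval n suc 1 (λ i → refl))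

concatMap-nil : ∀ {A B : Set} (f : A → List B) {xs} → All (λ x → f x ≡ []) xs → concatMap f xs ≡ []
concatMap-nil f [] = refl
concatMap-nil f (e ∷ es) rewrite e = concatMap-nil f es

concatMap-singleton : ∀ {A B : Set} (f : A → List B) (g : A → B) {xs} →
                      All (λ x → f x ≡ g x ∷ []) xs → concatMap f xs ≡ map g xs
concatMap-singleton f g [] = refl
concatMap-singleton f g (e ∷ es) rewrite e = cong (_ ∷_) (concatMap-singleton f g es)

concatMap-cong : ∀ {A B : Set} (f g : A → List B) {xs} → All (λ x → f x ≡ g x) xs →
                 concatMap f xs ≡ concatMap g xs
concatMap-cong f g [] = refl
concatMap-cong f g (e ∷ es) = cong₂ _++_ e (concatMap-cong f g es)

concatMap-window : ∀ {A B : Set} (f g : A → List B) {xs ys zs} →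
                   All (λ x → f x ≡ []) xs → All (λ x → f x ≡ g x) ys → All (λ x → f x ≡ []) zs →
                   concatMap f (xs ++ ys ++ zs) ≡ concatMap g ys
concatMap-window f g {xs} {ys} {zs} before middle after = begin
  concatMap f (xs ++ ys ++ zs)               ≡⟨ concatMap-++ f xs (ys ++ zs) ⟩
  concatMap f xs ++ concatMap f (ys ++ zs)   ≡⟨ cong₂ _++_ (concatMap-nil f before) (concatMap-++ f ys zs) ⟩
  concatMap f ys ++ concatMap f zs           ≡⟨ cong₂ _++_ (concatMap-cong f g middle) (concatMap-nil f after) ⟩
  concatMap g ys ++ []                       ≡⟨ ++-identityʳ _ ⟩
  concatMap g ys                             ∎
  where open ≡-Reasoning

sumMap : (ℕ → ℕ) → List ℕ → ℕ
sumMap f [] = 0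
sumMap f (x ∷ xs) = f x + sumMap f xs

sumMap-++ : ∀ f xs ys → sumMap f (xs ++ ys) ≡ sumMap f xs + sumMap f ys
sumMap-++ f [] ys = refl
sumMap-++ f (x ∷ xs) ys rewrite sumMap-++ f xs ys = sym (+-assoc (f x) (sumMap f xs) (sumMap f ys))

sumMap-distrib-+ : ∀ f g xs → sumMap (λ x → f x + g x) xs ≡ sumMap f xs + sumMap g xs
sumMap-distrib-+ f g [] = refl
sumMap-distrib-+ f g (x ∷ xs) rewrite sumMap-distrib-+ f g xs = interchange (f x) (g x) (sumMap f xs) (sumMap g xs)
  where interchange : ∀ p q r t → p + q + (r + t) ≡ p + r + (q + t)
        interchange = solve-∀

sumMap-cong : ∀ (f g : ℕ → ℕ) {xs} → All (λ x → f x ≡ g x) xs → sumMap f xs ≡ sumMap g xs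
sumMap-cong f g [] = refl
sumMap-cong f g (e ∷ es) = cong₂ _+_ e (sumMap-cong f g es)

sumMap-const : ∀ k xs → sumMap (λ _ → k) xs ≡ length xs * k
sumMap-const k [] = refl
sumMap-const k (x ∷ xs) = cong (k +_) (sumMap-const k xs)

sumMap-interval : ∀ f l → sumMap f (interval 1 l) ≡ sumTo l f
sumMap-interval f zero = refl
sumMap-interval f (suc l) = begin
  sumMap f (interval 1 (suc l))                   ≡⟨ cong (sumMap f) (interval-snoc 1 l) ⟩
  sumMap f (interval 1 l ++ suc l ∷ [])           ≡⟨ sumMap-++ f (interval 1 l) (suc l ∷ []) ⟩
  sumMap f (interval 1 l) + (f (suc l) + 0)       ≡⟨ cong₂ _+_ (sumMap-interval f l) (+-identityʳ (f (suc l))) ⟩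
  sumTo l f + f (suc l)                           ∎
  where open ≡-Reasoning

filterᵇ-accept : ∀ {A : Set} (p : A → Bool) {x} xs → p x ≡ true → filterᵇ p (x ∷ xs) ≡ x ∷ filterᵇ p xs
filterᵇ-accept p {x} xs e with p x
... | true = refl

filterᵇ-reject : ∀ {A : Set} (p : A → Bool) {x} xs → p x ≡ false → filterᵇ p (x ∷ xs) ≡ filterᵇ p xs
filterᵇ-reject p {x} xs e with p x
... | false = refl

length-filterᵇ-++ : ∀ {A : Set} (p : A → Bool) xs ys →
                    length (filterᵇ p (xs ++ ys)) ≡ length (filterᵇ p xs) + length (filterᵇ p ys)
length-filterᵇ-++ p xs ys = trans (cong length (filter-++ (T? ∘ p) xs ys)) (length-++ (filterᵇ p xs))

length-filterᵇ-map : ∀ {A B : Set} (p : B → Bool) (g : A → B) xs →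
                     length (filterᵇ p (map g xs)) ≡ length (filterᵇ (p ∘ g) xs)
length-filterᵇ-map p g [] = refl
length-filterᵇ-map p g (x ∷ xs) with p (g x) in e
... | true = cong suc (length-filterᵇ-map p g xs)
... | false = length-filterᵇ-map p g xs

length-filterᵇ-cong : ∀ {A : Set} (p q : A → Bool) {xs} → All (λ x → p x ≡ q x) xs →
                      length (filterᵇ p xs) ≡ length (filterᵇ q xs)
length-filterᵇ-cong p q [] = refl
length-filterᵇ-cong p q {x ∷ xs} (e ∷ es) with q x in e'
... | true rewrite filterᵇ-accept p xs e = cong suc (length-filterᵇ-cong p q es)
... | false rewrite filterᵇ-reject p xs e = length-filterᵇ-cong p q es

filterᵇ-none : ∀ {A : Set} (p : A → Bool) {xs} → All (λ x → p x ≡ false) xs → filterᵇ p xs ≡ []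
filterᵇ-none p [] = refl
filterᵇ-none p {x ∷ xs} (e ∷ es) rewrite filterᵇ-reject p xs e = filterᵇ-none p es

count-≢-interval : ∀ j lo l → lo ≤ j → j < lo + l →
                   length (filterᵇ (λ j' → not (j ≡ᵇ j')) (interval lo l)) ≡ l ∸ 1
count-≢-interval j lo zero lj jl = ⊥-elim (<-irrefl refl (<-≤-trans jl (subst (_≤ j) (sym (+-identityʳ lo)) lj)))
count-≢-interval j lo (suc l) lj jl with j ≟ lo
... | yes refl rewrite filterᵇ-reject (λ j' → not (j ≡ᵇ j')) (interval (suc j) l) (cong not (≡ᵇ-refl j)) =
  allKept (suc j) l ≤-refl
  where
  allKept : ∀ lo' l' → j < lo' → length (filterᵇ (λ j' → not (j ≡ᵇ j')) (interval lo' l')) ≡ l'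
  allKept lo' zero _ = refl
  allKept lo' (suc l') jl' rewrite filterᵇ-accept (λ j' → not (j ≡ᵇ j')) (interval (suc lo') l')
                                     (cong not (≢⇒≡ᵇ-false j lo' (<⇒≢ jl'))) =
    cong suc (allKept (suc lo') l' (m<n⇒m<1+n jl'))
... | no ne
  rewrite filterᵇ-accept (λ j' → not (j ≡ᵇ j')) (interval (suc lo) l) (cong not (≢⇒≡ᵇ-false j lo ne)) =
  trans (cong suc (count-≢-interval j (suc lo) l lo<j (subst (j <_) (+-suc lo l) jl))) (suc[n∸1]≡n 1≤l)
  where
  lo<j : lo < j
  lo<j = ≤∧≢⇒< lj (ne ∘ sym)
  1≤l : 1 ≤ l
  1≤l = +-cancelˡ-≤ lo 1 l
          (subst (_≤ lo + l) (+-comm 1 lo) (≤-trans lo<j (≤-pred (subst (j <_) (+-suc lo l) jl))))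

countLess : ℕ → List ℕ → ℕ
countLess x = sumMap (λ y → bit (y <ᵇ x))

invList : List ℕ → ℕ
invList [] = 0
invList (x ∷ xs) = countLess x xs + invList xs

crossLess : List ℕ → List ℕ → ℕ
crossLess xs ys = sumMap (λ x → countLess x ys) xs

data AdjacentSwap : List ℕ → List ℕ → Set where
  swap : ∀ p x y q → AdjacentSwap (p ++ x ∷ y ∷ q) (p ++ y ∷ x ∷ q)

sumMap-swap : ∀ f p x y q → sumMap f (p ++ x ∷ y ∷ q) ≡ sumMap f (p ++ y ∷ x ∷ q)
sumMap-swap f [] x y q = solve-∀-swap (f x) (f y) (sumMap f q)
  where solve-∀-swap : ∀ A B C → A + (B + C) ≡ B + (A + C)
        solve-∀-swap = solve-∀
sumMap-swap f (w ∷ p) x y q = cong (f w +_) (sumMap-swap f p x y q)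

invList-adjacentSwap : ∀ {κ κ'} → AdjacentSwap κ κ' → invList κ ≤ invList κ' + 1
invList-adjacentSwap (swap (w ∷ p) x y q) = begin
  countLess w (p ++ x ∷ y ∷ q) + invList (p ++ x ∷ y ∷ q)
    ≤⟨ +-mono-≤ (≤-reflexive (sumMap-swap _ p x y q)) (invList-adjacentSwap (swap p x y q)) ⟩
  countLess w (p ++ y ∷ x ∷ q) + (invList (p ++ y ∷ x ∷ q) + 1)
    ≡⟨ +-assoc (countLess w (p ++ y ∷ x ∷ q)) _ 1 ⟨
  countLess w (p ++ y ∷ x ∷ q) + invList (p ++ y ∷ x ∷ q) + 1
    ∎
  where open ≤-Reasoning
invList-adjacentSwap (swap [] x y q) = begin
  bit (y <ᵇ x) + P + (Q + R)       ≡⟨ rearrange₁ (bit (y <ᵇ x)) P Q R ⟩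
  P + Q + R + bit (y <ᵇ x)         ≤⟨ +-monoʳ-≤ (P + Q + R) (bit≤1 (y <ᵇ x)) ⟩
  P + Q + R + 1                    ≤⟨ +-monoˡ-≤ 1 (+-monoˡ-≤ R (m≤n+m (P + Q) (bit (x <ᵇ y)))) ⟩
  bit (x <ᵇ y) + (P + Q) + R + 1   ≡⟨ rearrange₂ (bit (x <ᵇ y)) P Q R ⟩
  bit (x <ᵇ y) + Q + (P + R) + 1   ∎
  where
  open ≤-Reasoning
  P = countLess x q
  Q = countLess y q
  R = invList q
  rearrange₁ : ∀ A P Q R → A + P + (Q + R) ≡ P + Q + R + A
  rearrange₁ = solve-∀
  rearrange₂ : ∀ B P Q R → B + (P + Q) + R + 1 ≡ B + Q + (P + R) + 1
  rearrange₂ = solve-∀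

invList-++ : ∀ xs ys → invList (xs ++ ys) ≡ invList xs + invList ys + crossLess xs ys
invList-++ [] ys = sym (+-identityʳ (invList ys))
invList-++ (x ∷ xs) ys rewrite sumMap-++ (λ y → bit (y <ᵇ x)) xs ys | invList-++ xs ys =
  rearrange (countLess x xs) (countLess x ys) (invList xs) (invList ys) (crossLess xs ys)
  where rearrange : ∀ A B C D F → A + B + (C + D + F) ≡ A + C + D + (B + F)
        rearrange = solve-∀

countLess-none : ∀ x {ys} → All (x ≤_) ys → countLess x ys ≡ 0
countLess-none x [] = refl
countLess-none x {y ∷ ys} (p ∷ ps) rewrite ≮⇒<ᵇ-false y x (≤⇒≯ p) = countLess-none x ps

All-≤-interval : ∀ {x} lo l → x ≤ lo → All (x ≤_) (interval lo l)
All-≤-interval lo l p = All-interval lo l (λ y ly _ → ≤-trans p ly)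

invList-interval : ∀ lo l → invList (interval lo l) ≡ 0
invList-interval lo zero = refl
invList-interval lo (suc l) rewrite countLess-none lo (All-≤-interval (suc lo) l (n≤1+n lo)) =
  invList-interval (suc lo) l

countBelow-interval : ∀ a x → InRange a x → sumTo a (λ y → bit (y <ᵇ x)) ≡ x ∸ 1
countBelow-interval a x (1≤x , x≤a) =
  trans (sumTo-trailingZeros (x ∸ 1) a notBelow (≤-trans (m∸n≤m x 1) x≤a)) (sumTo-ones (x ∸ 1) below)
  where
  notBelow : ∀ y → x ∸ 1 < y → y ≤ a → bit (y <ᵇ x) ≡ 0
  notBelow y lt _
    rewrite ≮⇒<ᵇ-false y x (λ y<x → <⇒≱ lt (≤-pred (subst (y <_) (sym (suc[n∸1]≡n 1≤x)) y<x))) = refl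
  below : ∀ y → InRange (x ∸ 1) y → bit (y <ᵇ x) ≡ 1
  below y (_ , y≤) rewrite <⇒<ᵇ-true y x (≤∸1⇒< 1≤x y≤) = refl

orderedPairs : ∀ a → sumTo a (λ x → sumTo a (λ y → bit (y <ᵇ x))) ≡ choose2 a
orderedPairs a = trans (sumTo-cong a (countBelow-interval a)) (sumPreds a)
  where
  sumPreds : ∀ a → sumTo a (_∸ 1) ≡ choose2 a
  sumPreds zero = refl
  sumPreds (suc a) rewrite sumPreds a = +-comm (choose2 a) a

crossLess-interval : ∀ a → crossLess (interval 1 a) (interval 1 a) ≡ choose2 a
crossLess-interval a = begin
  sumMap (λ x → countLess x (interval 1 a)) (interval 1 a)
    ≡⟨ sumMap-cong _ _ (All.universal (λ x → sumMap-interval (λ y → bit (y <ᵇ x)) a) (interval 1 a)) ⟩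
  sumMap (λ x → sumTo a (λ y → bit (y <ᵇ x))) (interval 1 a)
    ≡⟨ sumMap-interval _ a ⟩
  sumTo a (λ x → sumTo a (λ y → bit (y <ᵇ x)))
    ≡⟨ orderedPairs a ⟩
  choose2 a
    ∎
  where open ≡-Reasoning

crossDisjoint : List (ℕ × ℕ) → List (ℕ × ℕ) → ℕ
crossDisjoint [] ys = 0
crossDisjoint (x ∷ xs) ys = length (filterᵇ (disjointᵇ x) ys) + crossDisjoint xs ys

crossDisjoint-[] : ∀ xs → crossDisjoint xs [] ≡ 0
crossDisjoint-[] [] = refl
crossDisjoint-[] (x ∷ xs) = crossDisjoint-[] xs

crossDisjoint-++ʳ : ∀ xs ys zs → crossDisjoint xs (ys ++ zs) ≡ crossDisjoint xs ys + crossDisjoint xs zs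
crossDisjoint-++ʳ [] ys zs = refl
crossDisjoint-++ʳ (x ∷ xs) ys zs rewrite length-filterᵇ-++ (disjointᵇ x) ys zs | crossDisjoint-++ʳ xs ys zs =
  interchange (length (filterᵇ (disjointᵇ x) ys)) (length (filterᵇ (disjointᵇ x) zs))
              (crossDisjoint xs ys) (crossDisjoint xs zs)
  where interchange : ∀ A B C D → A + B + (C + D) ≡ A + C + (B + D)
        interchange = solve-∀

disjointPairs-++ : ∀ xs ys → disjointPairs (xs ++ ys) ≡ disjointPairs xs + disjointPairs ys + crossDisjoint xs ys
disjointPairs-++ [] ys = sym (+-identityʳ _)
disjointPairs-++ (x ∷ xs) ys rewrite length-filterᵇ-++ (disjointᵇ x) xs ys | disjointPairs-++ xs ys =
  rearrange (length (filterᵇ (disjointᵇ x) xs)) (length (filterᵇ (disjointᵇ x) ys))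
            (disjointPairs xs) (disjointPairs ys) (crossDisjoint xs ys)
  where rearrange : ∀ A B C D F → A + B + (C + D + F) ≡ A + C + D + (B + F)
        rearrange = solve-∀

row : ℕ → List ℕ → List (ℕ × ℕ)
row i = map (i ,_)

rows : ℕ → ℕ → List ℕ → List (ℕ × ℕ)
rows lo m js = concatMap (λ i → row i js) (interval lo m)

disjointᵇ-sameFirst : ∀ i j j' → disjointᵇ (i , j) (i , j') ≡ false
disjointᵇ-sameFirst i j j' rewrite ≡ᵇ-refl i = refl

disjointPairs-row : ∀ i js → disjointPairs (row i js) ≡ 0
disjointPairs-row i [] = refl
disjointPairs-row i (j ∷ js)
  rewrite length-filterᵇ-map (disjointᵇ (i , j)) (i ,_) js
        | filterᵇ-none (disjointᵇ (i , j) ∘ (i ,_)) (All.universal (disjointᵇ-sameFirst i j) js)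
        | disjointPairs-row i js = refl

crossDisjoint-row-row : ∀ {i i'} lo l → i ≢ i' → i < lo → i' < lo →
                        crossDisjoint (row i (interval lo l)) (row i' (interval lo l)) ≡ l * (l ∸ 1)
crossDisjoint-row-row {i} {i'} lo l i≢i' i<lo i'<lo = begin
  crossDisjoint (row i js) (row i' js)  ≡⟨ asSum js ⟩
  sumMap partners js                    ≡⟨ sumMap-cong _ _ (All-interval lo l othersCount) ⟩
  sumMap (λ _ → l ∸ 1) js               ≡⟨ sumMap-const (l ∸ 1) js ⟩
  length js * (l ∸ 1)                   ≡⟨ cong (_* (l ∸ 1)) (length-interval lo l) ⟩
  l * (l ∸ 1)                           ∎
  where
  open ≡-Reasoning
  js = interval lo l
  partners : ℕ → ℕ
  partners j = length (filterᵇ (disjointᵇ (i , j)) (row i' js))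
  asSum : ∀ ks → crossDisjoint (row i ks) (row i' js) ≡ sumMap partners ks
  asSum [] = refl
  asSum (k ∷ ks) = cong (_ +_) (asSum ks)
  othersCount : ∀ j → lo ≤ j → j < lo + l → partners j ≡ l ∸ 1
  othersCount j lo≤j j<end = begin
    partners j                                         ≡⟨ length-filterᵇ-map (disjointᵇ (i , j)) (i' ,_) js ⟩
    length (filterᵇ (disjointᵇ (i , j) ∘ (i' ,_)) js)  ≡⟨ length-filterᵇ-cong _ _ (All-interval lo l onlySecond) ⟩
    length (filterᵇ (λ j' → not (j ≡ᵇ j')) js)         ≡⟨ count-≢-interval j lo l lo≤j j<end ⟩
    l ∸ 1                                              ∎
    where
    onlySecond : ∀ j' → lo ≤ j' → j' < lo + l → disjointᵇ (i , j) (i' , j') ≡ not (j ≡ᵇ j')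
    onlySecond j' lo≤j' _
      rewrite ≢⇒≡ᵇ-false i i' i≢i' | ≢⇒≡ᵇ-false i j' (<⇒≢ (<-≤-trans i<lo lo≤j'))
            | ≢⇒≡ᵇ-false j i' (>⇒≢ (<-≤-trans i'<lo lo≤j)) = refl

crossDisjoint-row-rows : ∀ {i} lo m lo' l → i < lo → lo + m ≤ lo' →
                         crossDisjoint (row i (interval lo' l)) (rows lo m (interval lo' l)) ≡ m * (l * (l ∸ 1))
crossDisjoint-row-rows {i} lo zero lo' l _ _ = crossDisjoint-[] (row i (interval lo' l))
crossDisjoint-row-rows {i} lo (suc m) lo' l i<lo end
  rewrite crossDisjoint-++ʳ (row i (interval lo' l)) (row lo (interval lo' l)) (rows (suc lo) m (interval lo' l)) =
  cong₂ _+_ (crossDisjoint-row-row lo' l (<⇒≢ i<lo) (<-trans i<lo lo<lo') lo<lo')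
            (crossDisjoint-row-rows (suc lo) m lo' l (m<n⇒m<1+n i<lo) (subst (_≤ lo') (+-suc lo m) end))
  where lo<lo' : lo < lo'
        lo<lo' = <-≤-trans (<-interval-end lo m) end

disjointPairs-rows : ∀ lo m lo' l → lo + m ≤ lo' →
                     disjointPairs (rows lo m (interval lo' l)) ≡ choose2 m * (l * (l ∸ 1))
disjointPairs-rows lo zero lo' l _ = refl
disjointPairs-rows lo (suc m) lo' l end
  rewrite disjointPairs-++ (row lo (interval lo' l)) (rows (suc lo) m (interval lo' l))
        | disjointPairs-row lo (interval lo' l)
        | disjointPairs-rows (suc lo) m lo' l (subst (_≤ lo') (+-suc lo m) end)
        | crossDisjoint-row-rows (suc lo) m lo' l (n<1+n lo) (subst (_≤ lo') (+-suc lo m) end) =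
  trans (+-comm (choose2 m * K) (m * K)) (sym (*-distribʳ-+ K m (choose2 m)))
  where K = l * (l ∸ 1)

module Fillings (a b c d : ℕ) where

  n : ℕ
  n = a + b + c + d

  -- h k cells remain in column k; the sentinel h 0 = 0 makes column 1 a corner exactly when nonempty.
  record IsShape (h : ℕ → ℕ) : Set where
    field
      at-0     : h 0 ≡ 0
      monotone : ∀ i j → i ≤ j → j ≤ a → h i ≤ h j
      bounded  : ∀ i → i ≤ a → h i ≤ b
  open IsShape

  record Corner (h : ℕ → ℕ) (k : ℕ) : Set where
    constructor corner
    field
      column : InRange a k
      rises  : h (k ∸ 1) < h k
  open Corner

  column≥1 : ∀ {h k} → Corner h k → 1 ≤ k
  column≥1 = proj₁ ∘ column

  column≤a : ∀ {h k} → Corner h k → k ≤ a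
  column≤a = proj₂ ∘ column

  lower : (ℕ → ℕ) → ℕ → ℕ → ℕ
  lower h k i = if i ≡ᵇ k then h i ∸ 1 else h i

  -- Removing the top cell of column k writes the generator s_(letter h k).
  letter : (ℕ → ℕ) → ℕ → ℕ
  letter h k = c + k + h k ∸ 1

  aValue : (ℕ → ℕ) → ℕ → ℕ
  aValue h k = c + k + h k

  Cleared : (ℕ → ℕ) → Set
  Cleared h = ∀ k → InRange a k → h k ≡ 0

  lower-at : ∀ h k → lower h k k ≡ h k ∸ 1
  lower-at h k rewrite ≡ᵇ-refl k = refl

  lower-elsewhere : ∀ h k i → i ≢ k → lower h k i ≡ h i
  lower-elsewhere h k i ne rewrite ≢⇒≡ᵇ-false i k ne = refl

  lower-≤ : ∀ h k i → lower h k i ≤ h i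
  lower-≤ h k i with i ≟ k
  ... | yes refl rewrite lower-at h i = m∸n≤m (h i) 1
  ... | no ne rewrite lower-elsewhere h k i ne = ≤-refl

  lower-cong : ∀ {h h'} → (∀ i → h i ≡ h' i) → ∀ k i → lower h k i ≡ lower h' k i
  lower-cong e k i rewrite e i = refl

  lower-comm : ∀ h k k' → k ≢ k' → ∀ i → lower (lower h k') k i ≡ lower (lower h k) k' i
  lower-comm h k k' ne i with i ≟ k | i ≟ k'
  ... | yes refl | yes refl = ⊥-elim (ne refl)
  ... | yes refl | no n2
    rewrite lower-at (lower h k') i | lower-elsewhere h k' i n2 | lower-elsewhere (lower h i) k' i n2 | lower-at h i = refl
  ... | no n1 | yes refl
    rewrite lower-elsewhere (lower h i) k i n1 | lower-at h i | lower-at (lower h k) i | lower-elsewhere h k i n1 = refl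
  ... | no n1 | no n2
    rewrite lower-elsewhere (lower h k') k i n1 | lower-elsewhere h k' i n2
          | lower-elsewhere (lower h k) k' i n2 | lower-elsewhere h k i n1 = refl

  corner-positive : ∀ {h k} → Corner h k → 1 ≤ h k
  corner-positive m = ≤-trans (s≤s z≤n) (rises m)

  corner-strict : ∀ {h k} → IsShape h → Corner h k → ∀ i → i < k → h i < h k
  corner-strict g (corner (_ , k≤a) rise) i i<k =
    ≤-<-trans (monotone g i _ (∸-monoˡ-≤ 1 i<k) (≤-trans (m∸n≤m _ 1) k≤a)) rise

  corner-lower : ∀ {h k k'} → Corner h k → k ≢ k' → Corner (lower h k') k
  corner-lower {h} {k} {k'} (corner ik rise) ne =
    corner ik (≤-<-trans (lower-≤ h k' (k ∸ 1)) (subst (_ <_) (sym (lower-elsewhere h k' k ne)) rise))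

  cleared⇒¬corner : ∀ {h k} → Cleared h → Corner h k → ⊥
  cleared⇒¬corner dn m = <-irrefl (sym (dn _ (column m))) (corner-positive m)

  lower-shape : ∀ {h k} → IsShape h → Corner h k → IsShape (lower h k)
  lower-shape {h} {k} g m = record { at-0 = at-0′ ; monotone = monotone′ ; bounded = bounded′ }
    where
    at-0′ : lower h k 0 ≡ 0
    at-0′ = trans (lower-elsewhere h k 0 (<⇒≢ (column≥1 m))) (at-0 g)
    monotone′ : ∀ i j → i ≤ j → j ≤ a → lower h k i ≤ lower h k j
    monotone′ i j ij ja with i ≟ k | j ≟ k
    ... | yes refl | yes refl = ≤-refl
    ... | yes refl | no nj rewrite lower-at h i | lower-elsewhere h i j nj = ≤-trans (m∸n≤m (h i) 1) (monotone g i j ij ja)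
    ... | no ni | yes refl rewrite lower-at h j | lower-elsewhere h j i ni =
      subst (_≤ h j ∸ 1) (m+n∸n≡m (h i) 1)
            (∸-monoˡ-≤ 1 (subst (_≤ h j) (+-comm 1 (h i)) (corner-strict g m i (≤∧≢⇒< ij ni))))
    ... | no ni | no nj rewrite lower-elsewhere h k i ni | lower-elsewhere h k j nj = monotone g i j ij ja
    bounded′ : ∀ i → i ≤ a → lower h k i ≤ b
    bounded′ i ia = ≤-trans (lower-≤ h k i) (bounded g i ia)

  suc-letter : ∀ h k → 1 ≤ k → suc (letter h k) ≡ aValue h k
  suc-letter h k k≥1 = suc[n∸1]≡n (≤-trans k≥1 (≤-trans (m≤n+m k c) (m≤m+n (c + k) (h k))))

  suc-letter-corner : ∀ {h k} → Corner h k → suc (letter h k) ≡ aValue h k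
  suc-letter-corner {h} {k} cr = suc-letter h k (column≥1 cr)

  aValue-lower-at : ∀ {h k} → Corner h k → aValue (lower h k) k ≡ letter h k
  aValue-lower-at {h} {k} cr = trans (cong (c + k +_) (lower-at h k)) (sym (+-∸-assoc (c + k) (corner-positive cr)))

  suc-letter-lower : ∀ {h k} → Corner h k → suc (letter (lower h k) k) ≡ letter h k
  suc-letter-lower {h} {k} cr = trans (suc-letter (lower h k) k (column≥1 cr)) (aValue-lower-at cr)

  letter-lower : ∀ h k k' → k ≢ k' → letter (lower h k') k ≡ letter h k
  letter-lower h k k' ne = cong (λ t → c + k + t ∸ 1) (lower-elsewhere h k' k ne)

  aValue-< : ∀ {h} → IsShape h → ∀ k₁ k₂ → k₁ < k₂ → k₂ ≤ a → aValue h k₁ < aValue h k₂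
  aValue-< g k₁ k₂ lt ka = +-mono-<-≤ (+-monoʳ-< c lt) (monotone g k₁ k₂ (<⇒≤ lt) ka)

  aValue-≤ : ∀ {h} → IsShape h → ∀ k → k ≤ a → aValue h k ≤ c + a + b
  aValue-≤ g k ka = +-mono-≤ (+-monoʳ-≤ c ka) (bounded g k ka)

  aValue-gap : ∀ {h k} → IsShape h → Corner h k → ∀ k' → k' < k → aValue h k' + 2 ≤ aValue h k
  aValue-gap {h} {k} g m k' lt =
    subst (_≤ aValue h k) (rearrange c k' (h k')) (+-mono-≤ (+-monoʳ-≤ c lt) (corner-strict g m k' lt))
    where rearrange : ∀ c k h → c + suc k + suc h ≡ c + k + h + 2
          rearrange = solve-∀

  aValue-injective : ∀ {h} → IsShape h → ∀ k₁ k₂ → InRange a k₁ → InRange a k₂ →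
                     aValue h k₁ ≡ aValue h k₂ → k₁ ≡ k₂
  aValue-injective g k₁ k₂ (_ , a₁) (_ , a₂) e with <-cmp k₁ k₂
  ... | tri< lt _ _ = ⊥-elim (<-irrefl e (aValue-< g k₁ k₂ lt a₂))
  ... | tri≈ _ eq _ = eq
  ... | tri> _ _ gt = ⊥-elim (<-irrefl (sym e) (aValue-< g k₂ k₁ gt a₁))

  letter-injective : ∀ {h} → IsShape h → ∀ k₁ k₂ → InRange a k₁ → InRange a k₂ →
                     letter h k₁ ≡ letter h k₂ → k₁ ≡ k₂
  letter-injective {h} g k₁ k₂ i₁ i₂ e = aValue-injective g k₁ k₂ i₁ i₂
    (trans (sym (suc-letter h k₁ (proj₁ i₁))) (trans (cong suc e) (suc-letter h k₂ (proj₁ i₂))))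

  letter-gap : ∀ {h k k'} → IsShape h → Corner h k' → Corner h k → k' < k → suc (letter h k') < letter h k
  letter-gap {h} {k} {k'} g m' m lt = +-cancelˡ-≤ 1 _ _ (begin
    suc (suc (suc (letter h k')))  ≡⟨ cong (suc ∘ suc) (suc-letter-corner m') ⟩
    suc (suc (aValue h k'))        ≡⟨ +-comm 2 (aValue h k') ⟩
    aValue h k' + 2                ≤⟨ aValue-gap g m k' lt ⟩
    aValue h k                     ≡⟨ suc-letter-corner m ⟨
    suc (letter h k)               ∎)
    where open ≤-Reasoning

  letters-far : ∀ {h k k'} → IsShape h → Corner h k → Corner h k' → k ≢ k' → Far (letter h k) (letter h k')
  letters-far {k = k} {k'} g m m' ne with <-cmp k k'
  ... | tri< lt _ _ = inj₁ (letter-gap g m m' lt)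
  ... | tri≈ _ eq _ = ⊥-elim (ne eq)
  ... | tri> _ _ gt = inj₂ (letter-gap g m' m gt)

  aValue-adjacent : ∀ {h} → IsShape h → ∀ k₁ k₂ → InRange a k₁ → InRange a k₂ →
                    aValue h k₂ ≡ suc (aValue h k₁) → k₂ ≡ suc k₁ × h k₂ ≡ h k₁
  aValue-adjacent {h} g k₁ k₂ i₁ i₂ e with <-cmp k₁ k₂
  ... | tri> _ _ gt = ⊥-elim (<-asym (aValue-< g k₂ k₁ gt (proj₂ i₁)) (subst (aValue h k₁ <_) (sym e) (n<1+n _)))
  ... | tri≈ _ refl _ = ⊥-elim (<-irrefl e (n<1+n _))
  ... | tri< lt _ _ with suc k₁ ≟ k₂
  ...   | yes refl = refl , +-cancelˡ-≡ (c + k₁) _ _ (suc-injective (trans (sym (rearrange c k₁ (h (suc k₁)))) e))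
    where rearrange : ∀ c k x → c + suc k + x ≡ suc (c + k + x)
          rearrange = solve-∀
  ...   | no ne =
    ⊥-elim (<-irrefl (sym e) (≤-trans (s≤s (aValue-< g k₁ (suc k₁) ≤-refl (≤-trans lt (proj₂ i₂))))
                                                    (aValue-< g (suc k₁) k₂ (≤∧≢⇒< lt ne) (proj₂ i₂))))

  letter-suc⇒aValue-suc : ∀ {h h' k k'} → 1 ≤ k → 1 ≤ k' →
                          letter h' k' ≡ suc (letter h k) → aValue h' k' ≡ suc (aValue h k)
  letter-suc⇒aValue-suc {h} {h'} {k} {k'} k≥1 k'≥1 e =
    trans (sym (suc-letter h' k' k'≥1)) (cong suc (trans e (suc-letter h k k≥1)))

  countBelow : (ℕ → ℕ) → ℕ → ℕ
  countBelow h m = sumTo a (λ j → bit (h j <ᵇ m))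

  countBelow-≤ : ∀ {h} → IsShape h → ∀ k m → InRange a k → m ≤ h k → countBelow h m ≤ k ∸ 1
  countBelow-≤ {h} g k m (k≥1 , k≤a) m≤hk =
    ≤-trans (≤-reflexive (sumTo-trailingZeros (k ∸ 1) a notBelow (≤-trans (m∸n≤m k 1) k≤a)))
            (sumTo-bits-≤ (k ∸ 1) (λ j → bit≤1 _))
    where
    notBelow : ∀ j → k ∸ 1 < j → j ≤ a → bit (h j <ᵇ m) ≡ 0
    notBelow j kj ja with bit-<ᵇ-cases (h j) m
    ... | inj₁ (lt , _) =
      ⊥-elim (<⇒≱ lt (≤-trans m≤hk (monotone g k j (subst (_≤ j) (suc[n∸1]≡n k≥1) kj) ja)))
    ... | inj₂ (_ , e) = e

  countBelow-≥ : ∀ {h} → IsShape h → ∀ k m → k ≤ a → h k < m → k ≤ countBelow h m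
  countBelow-≥ {h} g k m ka lt = ≤-trans (≤-reflexive (sym (sumTo-ones k below))) (sumTo-prefix-≤ k a ka)
    where
    below : ∀ j → InRange k j → bit (h j <ᵇ m) ≡ 1
    below j (_ , jk) with bit-<ᵇ-cases (h j) m
    ... | inj₁ (_ , e) = e
    ... | inj₂ (nl , _) = ⊥-elim (nl (≤-<-trans (monotone g j k jk ka) lt))

  countBelow-mono : ∀ h m m' → m ≤ m' → countBelow h m ≤ countBelow h m'
  countBelow-mono h m m' m≤m' = sumTo-mono-≤ a (λ j _ → bitMono j)
    where
    bitMono : ∀ j → bit (h j <ᵇ m) ≤ bit (h j <ᵇ m')
    bitMono j with bit-<ᵇ-cases (h j) m | bit-<ᵇ-cases (h j) m'
    ... | inj₂ (_ , e) | _ rewrite e = z≤n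
    ... | inj₁ (_ , e) | inj₁ (_ , e') rewrite e | e' = ≤-refl
    ... | inj₁ (lt , _) | inj₂ (nl , _) = ⊥-elim (nl (≤-trans lt m≤m'))

  countBelow-≤a : ∀ h m → countBelow h m ≤ a
  countBelow-≤a h m = sumTo-bits-≤ a (λ j → bit≤1 _)

  countBelow-lower : ∀ {h k} → Corner h k → ∀ m → m ≢ h k → countBelow (lower h k) m ≡ countBelow h m
  countBelow-lower {h} {k} cr m ne = sumTo-cong a (λ j _ → sameBit j)
    where
    sameBit : ∀ j → bit (lower h k j <ᵇ m) ≡ bit (h j <ᵇ m)
    sameBit j with j ≟ k
    ... | no nj rewrite lower-elsewhere h k j nj = refl
    ... | yes refl rewrite lower-at h j with bit-<ᵇ-cases (h j ∸ 1) m | bit-<ᵇ-cases (h j) m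
    ... | inj₁ (_ , e) | inj₁ (_ , e') = trans e (sym e')
    ... | inj₂ (_ , e) | inj₂ (_ , e') = trans e (sym e')
    ... | inj₁ (lt , _) | inj₂ (nl , _) =
      ⊥-elim (nl (≤∧≢⇒< (subst (_≤ m) (suc[n∸1]≡n (corner-positive cr)) lt) (ne ∘ sym)))
    ... | inj₂ (nl , _) | inj₁ (lt , _) = ⊥-elim (nl (≤-<-trans (m∸n≤m (h j) 1) lt))

  countBelow-corner : ∀ {h k} → IsShape h → Corner h k → countBelow h (h k) ≡ k ∸ 1
  countBelow-corner {h} {k} g cr = ≤-antisym (countBelow-≤ g k (h k) (column cr) ≤-refl)
    (countBelow-≥ g (k ∸ 1) (h k) (≤-trans (m∸n≤m k 1) (column≤a cr)) (rises cr))

  countBelow-lower-corner : ∀ {h k} → IsShape h → Corner h k → countBelow (lower h k) (h k) ≡ k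
  countBelow-lower-corner {h} {k} g cr = ≤-antisym atMost
    (countBelow-≥ (lower-shape g cr) k (h k) (column≤a cr)
                  (subst (_≤ h k) (cong suc (sym (lower-at h k))) (≤-reflexive (suc[n∸1]≡n (corner-positive cr)))))
    where
    atMost : countBelow (lower h k) (h k) ≤ k
    atMost with k <? a
    ... | yes k<a = countBelow-≤ (lower-shape g cr) (suc k) (h k) (s≤s z≤n , k<a)
                      (≤-trans (monotone g k (suc k) (n≤1+n k) k<a)
                               (≤-reflexive (sym (lower-elsewhere h k (suc k) (>⇒≢ (n<1+n k))))))
    ... | no k≮a = ≤-trans (countBelow-≤a (lower h k) (h k)) (≮⇒≥ k≮a)

  -- The permutation still to be written when the cells of h remain: it fixes 1 … c and
  -- everything beyond c + a + b, sends c + k to c + k + h k (column k), and sends c + a + m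
  -- to c + m + (number of columns shorter than m).
  perm : (ℕ → ℕ) → ℕ → ℕ
  perm h p = if p ≤ᵇ c then p
             else if p ≤ᵇ c + a then p + h (p ∸ c)
             else if p ≤ᵇ c + a + b then p ∸ a + countBelow h (p ∸ (c + a))
             else p

  bValue : (ℕ → ℕ) → ℕ → ℕ
  bValue h m = c + m + countBelow h m

  data Block (p : ℕ) : Set where
    inC : p ≤ c → Block p
    inA : ∀ k → InRange a k → p ≡ c + k → Block p
    inB : ∀ m → InRange b m → p ≡ c + a + m → Block p
    inD : c + a + b < p → Block p

  block : ∀ p → Block p
  block p with p ≤? c
  ... | yes p≤c = inC p≤c
  ... | no p≰c with p ≤? c + a
  ... | yes p≤c+a = inA (p ∸ c)
                        (m<n⇒0<n∸m (≰⇒> p≰c) , subst (p ∸ c ≤_) (m+n∸m≡n c a) (∸-monoˡ-≤ c p≤c+a))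
                        (sym (m+[n∸m]≡n (<⇒≤ (≰⇒> p≰c))))
  ... | no p≰c+a with p ≤? c + a + b
  ... | yes p≤c+a+b = inB (p ∸ (c + a))
                          (m<n⇒0<n∸m (≰⇒> p≰c+a) ,
                           subst (p ∸ (c + a) ≤_) (m+n∸m≡n (c + a) b) (∸-monoˡ-≤ (c + a) p≤c+a+b))
                          (sym (m+[n∸m]≡n (<⇒≤ (≰⇒> p≰c+a))))
  ... | no p≰c+a+b = inD (≰⇒> p≰c+a+b)

  c<c+k : ∀ {k} → 1 ≤ k → c < c + k
  c<c+k k≥1 = m<m+n c k≥1

  c+a≤c+a+b : c + a ≤ c + a + b
  c+a≤c+a+b = m≤m+n (c + a) b

  perm-C : ∀ h p → p ≤ c → perm h p ≡ p
  perm-C h p pc rewrite ≤⇒≤ᵇ-true p c pc = refl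

  perm-A : ∀ h k → InRange a k → perm h (c + k) ≡ aValue h k
  perm-A h k (k≥1 , ka)
    rewrite ≰⇒≤ᵇ-false (c + k) c (<⇒≱ (c<c+k k≥1)) | ≤⇒≤ᵇ-true (c + k) (c + a) (+-monoʳ-≤ c ka)
          | m+n∸m≡n c k = refl

  perm-B : ∀ h m → InRange b m → perm h (c + a + m) ≡ bValue h m
  perm-B h m (m≥1 , mb)
    rewrite ≰⇒≤ᵇ-false (c + a + m) c (<⇒≱ (≤-<-trans (m≤m+n c a) (m<m+n (c + a) m≥1)))
          | ≰⇒≤ᵇ-false (c + a + m) (c + a) (<⇒≱ (m<m+n (c + a) m≥1))
          | ≤⇒≤ᵇ-true (c + a + m) (c + a + b) (+-monoʳ-≤ (c + a) mb) | m+n∸m≡n (c + a) m =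
    cong (_+ countBelow h m) (dropA c a m)
    where dropA : ∀ c a m → c + a + m ∸ a ≡ c + m
          dropA c a m rewrite +-assoc c a m | +-comm a m | sym (+-assoc c m a) = m+n∸n≡m (c + m) a

  perm-D : ∀ h p → c + a + b < p → perm h p ≡ p
  perm-D h p lt
    rewrite ≰⇒≤ᵇ-false p c (<⇒≱ (≤-<-trans (≤-trans (m≤m+n c a) c+a≤c+a+b) lt))
          | ≰⇒≤ᵇ-false p (c + a) (<⇒≱ (≤-<-trans c+a≤c+a+b lt))
          | ≰⇒≤ᵇ-false p (c + a + b) (<⇒≱ lt) = refl

  aValue->c : ∀ h k → InRange a k → c < aValue h k
  aValue->c h k (k≥1 , _) = <-≤-trans (c<c+k k≥1) (m≤m+n (c + k) (h k))

  bValue->c : ∀ h m → InRange b m → c < bValue h m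
  bValue->c h m (m≥1 , _) = <-≤-trans (c<c+k m≥1) (m≤m+n (c + m) (countBelow h m))

  bValue-≤ : ∀ h m → InRange b m → bValue h m ≤ c + a + b
  bValue-≤ h m (_ , mb) = subst (bValue h m ≤_) (rearrange c b a) (+-mono-≤ (+-monoʳ-≤ c mb) (countBelow-≤a h m))
    where rearrange : ∀ c b a → c + b + a ≡ c + a + b
          rearrange = solve-∀

  bValue-< : ∀ h {m m'} → m < m' → bValue h m < bValue h m'
  bValue-< h {m} {m'} lt = +-mono-<-≤ (+-monoʳ-< c lt) (countBelow-mono h m m' (<⇒≤ lt))

  perm-inversion : ∀ {h} → IsShape h → ∀ {p q} → p < q → perm h q < perm h p →
                   ∃[ k ] ∃[ m ] (InRange a k × InRange b m × p ≡ c + k × q ≡ c + a + m)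
  perm-inversion {h} g {p} {q} p<q q↓p = go (block p) (block q)
    where
    Goal : Set
    Goal = ∃[ k ] ∃[ m ] (InRange a k × InRange b m × p ≡ c + k × q ≡ c + a + m)
    ascending : ∀ {x y} → perm h p ≡ x → perm h q ≡ y → x ≤ y → Goal
    ascending refl refl le = ⊥-elim (<⇒≱ q↓p le)
    misplaced : q ≤ p → Goal
    misplaced le = ⊥-elim (<⇒≱ p<q le)
    go : Block p → Block q → Goal
    go (inA k ik refl) (inB m im refl) = k , m , ik , im , refl , refl
    go (inC pc) (inC qc) = ascending (perm-C h p pc) (perm-C h q qc) (<⇒≤ p<q)
    go (inC pc) (inA k ik refl) = ascending (perm-C h p pc) (perm-A h k ik) (≤-trans pc (<⇒≤ (aValue->c h k ik)))
    go (inC pc) (inB m im refl) = ascending (perm-C h p pc) (perm-B h m im) (≤-trans pc (<⇒≤ (bValue->c h m im)))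
    go (inC pc) (inD qd) = ascending (perm-C h p pc) (perm-D h q qd) (<⇒≤ p<q)
    go (inA k ik refl) (inA k' ik' refl) =
      ascending (perm-A h k ik) (perm-A h k' ik') (<⇒≤ (aValue-< g k k' (+-cancelˡ-< c k k' p<q) (proj₂ ik')))
    go (inA k ik refl) (inD qd) = ascending (perm-A h k ik) (perm-D h q qd) (≤-trans (aValue-≤ g k (proj₂ ik)) (<⇒≤ qd))
    go (inB m im refl) (inB m' im' refl) =
      ascending (perm-B h m im) (perm-B h m' im') (<⇒≤ (bValue-< h (+-cancelˡ-< (c + a) m m' p<q)))
    go (inB m im refl) (inD qd) = ascending (perm-B h m im) (perm-D h q qd) (≤-trans (bValue-≤ h m im) (<⇒≤ qd))
    go (inD pd) (inD qd) = ascending (perm-D h p pd) (perm-D h q qd) (<⇒≤ p<q)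
    go (inA k ik refl) (inC qc) = misplaced (≤-trans qc (m≤m+n c k))
    go (inB m im refl) (inC qc) = misplaced (≤-trans qc (≤-trans (m≤m+n c a) (m≤m+n (c + a) m)))
    go (inB m im refl) (inA k ik refl) = misplaced (≤-trans (+-monoʳ-≤ c (proj₂ ik)) (m≤m+n (c + a) m))
    go (inD pd) (inC qc) = misplaced (≤-trans qc (≤-trans (m≤m+n c a) (≤-trans c+a≤c+a+b (<⇒≤ pd))))
    go (inD pd) (inA k ik refl) = misplaced (≤-trans (+-monoʳ-≤ c (proj₂ ik)) (≤-trans c+a≤c+a+b (<⇒≤ pd)))
    go (inD pd) (inB m im refl) = misplaced (≤-trans (+-monoʳ-≤ (c + a) (proj₂ im)) (<⇒≤ pd))

  bValue-below : ∀ {h k m} → IsShape h → InRange a k → m < h k → suc (suc (bValue h m)) ≤ aValue h k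
  bValue-below {h} {k} {m} g ik@(k≥1 , _) lt = begin
    suc (suc (c + m + countBelow h m))  ≡⟨ rearrange c m (countBelow h m) ⟩
    c + suc m + suc (countBelow h m)    ≤⟨ +-mono-≤ (+-monoʳ-≤ c lt)
                                                    (≤∸1⇒< k≥1 (countBelow-≤ g k m ik (<⇒≤ lt))) ⟩
    c + h k + k                         ≡⟨ swap-last c (h k) k ⟩
    aValue h k                          ∎
    where
    open ≤-Reasoning
    rearrange : ∀ c m x → suc (suc (c + m + x)) ≡ c + suc m + suc x
    rearrange = solve-∀
    swap-last : ∀ c x k → c + x + k ≡ c + k + x
    swap-last = solve-∀

  bValue-above : ∀ {h k m} → IsShape h → k ≤ a → h k < m → suc (aValue h k) ≤ bValue h m
  bValue-above {h} {k} {m} g ka lt =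
    subst (_≤ bValue h m) (rearrange c k (h k)) (+-mono-≤ (+-monoʳ-≤ c lt) (countBelow-≥ g k m ka lt))
    where rearrange : ∀ c k x → c + suc x + k ≡ suc (c + k + x)
          rearrange = solve-∀

  bValue-flat : ∀ {h k} → IsShape h → InRange a k → 1 ≤ h k → h k ≤ h (k ∸ 1) →
                suc (suc (bValue h (h k))) ≤ aValue h k
  bValue-flat {h} {k} g (k≥1 , k≤a) hk≥1 flat with k ∸ 1 ≟ 0
  ... | yes k∸1≡0 = ⊥-elim (<⇒≱ hk≥1 (≤-trans flat (≤-reflexive (trans (cong h k∸1≡0) (at-0 g)))))
  ... | no k∸1≢0 = begin
    suc (suc (c + h k + countBelow h (h k)))  ≡⟨ rearrange c (h k) (countBelow h (h k)) ⟩
    c + h k + suc (suc (countBelow h (h k)))  ≤⟨ +-monoʳ-≤ (c + h k)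
                                                    (≤∸1⇒< k≥1 (≤∸1⇒< k∸1≥1 belowPrevious)) ⟩
    c + h k + k                               ≡⟨ swap-last c (h k) k ⟩
    aValue h k                                ∎
    where
    open ≤-Reasoning
    k∸1≥1 : 1 ≤ k ∸ 1
    k∸1≥1 = n≢0⇒n>0 k∸1≢0
    belowPrevious : countBelow h (h k) ≤ k ∸ 1 ∸ 1
    belowPrevious = countBelow-≤ g (k ∸ 1) (h k) (k∸1≥1 , ≤-trans (m∸n≤m k 1) k≤a) flat
    rearrange : ∀ c x y → suc (suc (c + x + y)) ≡ c + x + suc (suc y)
    rearrange = solve-∀
    swap-last : ∀ c x k → c + x + k ≡ c + k + x
    swap-last = solve-∀

  adjacentValues⇒corner : ∀ {h k m} → IsShape h → InRange a k → InRange b m →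
                          aValue h k ≡ suc (bValue h m) → m ≡ h k × Corner h k
  adjacentValues⇒corner {h} {k} {m} g ik im adjacent with <-cmp m (h k)
  ... | tri< lt _ _ = ⊥-elim (<-irrefl (sym adjacent) (bValue-below g ik lt))
  ... | tri> _ _ gt =
    ⊥-elim (1+n≰n (≤-trans (n≤1+n _) (subst (λ x → suc x ≤ bValue h m) adjacent (bValue-above g (proj₂ ik) gt))))
  ... | tri≈ _ refl _ = refl , corner ik rises′
    where
    rises′ : h (k ∸ 1) < h k
    rises′ with h (k ∸ 1) <? h k
    ... | yes r = r
    ... | no flat = ⊥-elim (<-irrefl (sym adjacent) (bValue-flat g ik (proj₁ im) (≮⇒≥ flat)))

  descent⇒corner : ∀ {h} → IsShape h → ∀ p q r → p < q → perm h p ≡ suc r → perm h q ≡ r →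
                   ∃[ k ] (Corner h k × r ≡ letter h k)
  descent⇒corner {h} g p q r p<q ep eq with perm-inversion g p<q (subst₂ _<_ (sym eq) (sym ep) (n<1+n r))
  ... | k , m , ik , im , refl , refl =
    k , proj₂ (adjacentValues⇒corner g ik im adjacent) ,
    suc-injective (trans (sym ep) (trans (perm-A h k ik) (sym (suc-letter h k (proj₁ ik)))))
    where
    adjacent : aValue h k ≡ suc (bValue h m)
    adjacent = trans (sym (perm-A h k ik)) (trans ep (cong suc (trans (sym eq) (perm-B h m im))))

  bValue-corner : ∀ {h k} → IsShape h → Corner h k → bValue h (h k) ≡ letter h k
  bValue-corner {h} {k} g cr = begin
    c + h k + countBelow h (h k)  ≡⟨ cong (c + h k +_) (countBelow-corner g cr) ⟩
    c + h k + (k ∸ 1)             ≡⟨ +-∸-assoc (c + h k) (column≥1 cr) ⟨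
    c + h k + k ∸ 1               ≡⟨ cong (_∸ 1) (swap-last c (h k) k) ⟩
    letter h k                    ∎
    where
    open ≡-Reasoning
    swap-last : ∀ c x k → c + x + k ≡ c + k + x
    swap-last = solve-∀

  bValue-lower-corner : ∀ {h k} → IsShape h → Corner h k → bValue (lower h k) (h k) ≡ aValue h k
  bValue-lower-corner {h} {k} g cr = trans (cong (c + h k +_) (countBelow-lower-corner g cr)) (swap-last c (h k) k)
    where swap-last : ∀ c x k → c + x + k ≡ c + k + x
          swap-last = solve-∀

  c+2≤aValue : ∀ {h k} → Corner h k → c + 2 ≤ aValue h k
  c+2≤aValue {h} {k} cr =
    subst (_≤ aValue h k) (+-assoc c 1 1) (+-mono-≤ (+-monoʳ-≤ c (column≥1 cr)) (corner-positive cr))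

  perm-lower-A : ∀ {h k} → IsShape h → Corner h k → ∀ k' → InRange a k' →
                 s (letter h k) (aValue h k') ≡ aValue (lower h k) k'
  perm-lower-A {h} {k} g cr k' ik' with <-cmp k' k
  ... | tri≈ _ refl _ = begin
    s (letter h k) (aValue h k)        ≡⟨ cong (s (letter h k)) (suc-letter h k (proj₁ ik')) ⟨
    s (letter h k) (suc (letter h k))  ≡⟨ s-right (letter h k) ⟩
    letter h k                         ≡⟨ aValue-lower-at cr ⟨
    aValue (lower h k) k               ∎
    where open ≡-Reasoning
  ... | tri< lt _ _ rewrite lower-elsewhere h k k' (<⇒≢ lt) = s-fixes-below (letter h k) (aValue h k')
    (subst₂ _≤_ (+-comm (aValue h k') 2) (sym (suc-letter-corner cr)) (aValue-gap g cr k' lt))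
  ... | tri> _ _ gt rewrite lower-elsewhere h k k' (>⇒≢ gt) = s-fixes-above (letter h k) (aValue h k')
    (subst (_< aValue h k') (sym (suc-letter-corner cr)) (aValue-< g k k' gt (proj₂ ik')))

  perm-lower-B : ∀ {h k} → IsShape h → Corner h k → ∀ m → InRange b m →
                 s (letter h k) (bValue h m) ≡ bValue (lower h k) m
  perm-lower-B {h} {k} g cr m im with <-cmp m (h k)
  ... | tri≈ _ refl _ = begin
    s (letter h k) (bValue h (h k))  ≡⟨ cong (s (letter h k)) (bValue-corner g cr) ⟩
    s (letter h k) (letter h k)      ≡⟨ s-left (letter h k) ⟩
    suc (letter h k)                 ≡⟨ suc-letter-corner cr ⟩
    aValue h k                       ≡⟨ bValue-lower-corner g cr ⟨
    bValue (lower h k) (h k)         ∎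
    where open ≡-Reasoning
  ... | tri< lt _ _ = trans
    (s-fixes-below (letter h k) (bValue h m) (subst (suc (suc (bValue h m)) ≤_) (sym (suc-letter-corner cr))
                                                    (bValue-below g (column cr) lt)))
    (cong (c + m +_) (sym (countBelow-lower cr m (<⇒≢ lt))))
  ... | tri> _ _ gt = trans
    (s-fixes-above (letter h k) (bValue h m) (subst (λ x → suc x ≤ bValue h m) (sym (suc-letter-corner cr))
                                                    (bValue-above g (column≤a cr) gt)))
    (cong (c + m +_) (sym (countBelow-lower cr m (>⇒≢ gt))))

  perm-lower : ∀ {h k} → IsShape h → Corner h k → ∀ p → s (letter h k) (perm h p) ≡ perm (lower h k) p
  perm-lower {h} {k} g cr p with block p
  ... | inC pc rewrite perm-C h p pc | perm-C (lower h k) p pc = s-fixes-below (letter h k) p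
    (≤-trans (subst (_≤ c + 2) (+-comm p 2) (+-monoˡ-≤ 2 pc))
             (subst (c + 2 ≤_) (sym (suc-letter-corner cr)) (c+2≤aValue cr)))
  ... | inD pd rewrite perm-D h p pd | perm-D (lower h k) p pd = s-fixes-above (letter h k) p
    (≤-<-trans (subst (_≤ c + a + b) (sym (suc-letter-corner cr)) (aValue-≤ g k (column≤a cr))) pd)
  ... | inA k' ik' refl rewrite perm-A h k' ik' | perm-A (lower h k) k' ik' = perm-lower-A g cr k' ik'
  ... | inB m im refl rewrite perm-B h m im | perm-B (lower h k) m im = perm-lower-B g cr m im

  data Run : (ℕ → ℕ) → List ℕ → List ℕ → Set where
    done   : ∀ {h} → Cleared h → Run h [] []
    remove : ∀ {h k x w κ} → Corner h k → x ≡ letter h k → Run (lower h k) w κ → Run h (x ∷ w) (k ∷ κ)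

  Run-cong : ∀ {h h' w κ} → (∀ i → h i ≡ h' i) → Run h w κ → Run h' w κ
  Run-cong e (done dn) = done (λ k ik → trans (sym (e k)) (dn k ik))
  Run-cong e (remove {k = k} (corner ik rise) ex r) =
    remove (corner ik (subst₂ _<_ (e (k ∸ 1)) (e k) rise)) (trans ex (cong (λ t → c + k + t ∸ 1) (e k)))
           (Run-cong (lower-cong e k) r)

  run-unique : ∀ {h w κ κ'} → IsShape h → Run h w κ → Run h w κ' → κ ≡ κ'
  run-unique g (done _) (done _) = refl
  run-unique g (remove {k = k₁} cr₁ e₁ r₁) (remove {k = k₂} cr₂ e₂ r₂)
    with letter-injective g k₁ k₂ (column cr₁) (column cr₂) (trans (sym e₁) e₂)
  ... | refl = cong (k₁ ∷_) (run-unique (lower-shape g cr₁) r₁ r₂)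

  perm-cleared : ∀ {h} → IsShape h → Cleared h → ∀ p → perm h p ≡ p
  perm-cleared {h} g dn p with block p
  ... | inC pc = perm-C h p pc
  ... | inD pd = perm-D h p pd
  ... | inA k ik refl = trans (perm-A h k ik) (trans (cong (c + k +_) (dn k ik)) (+-identityʳ (c + k)))
  ... | inB m im refl = trans (perm-B h m im) (trans (cong (c + m +_) allBelow) (swap-last c m a))
    where
    ha≡0 : h a ≡ 0
    ha≡0 with a ≟ 0
    ... | yes a≡0 = trans (cong h a≡0) (at-0 g)
    ... | no a≢0 = dn a (n≢0⇒n>0 a≢0 , ≤-refl)
    allBelow : countBelow h m ≡ a
    allBelow = ≤-antisym (countBelow-≤a h m) (countBelow-≥ g a m ≤-refl (subst (_< m) (sym ha≡0) (proj₁ im)))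
    swap-last : ∀ c m a → c + m + a ≡ c + a + m
    swap-last = solve-∀

  perm-raise : ∀ {h k} → IsShape h → Corner h k → ∀ p → s (letter h k) (perm (lower h k) p) ≡ perm h p
  perm-raise {h} g cr p = trans (cong (s _) (sym (perm-lower g cr p))) (s-involutive _ (perm h p))

  c+a+b≤n : c + a + b ≤ n
  c+a+b≤n = subst (_≤ n) (rearrange c a b) (m≤m+n (a + b + c) d)
    where rearrange : ∀ c a b → a + b + c ≡ c + a + b
          rearrange = solve-∀

  InRange-A : ∀ {k} → InRange a k → InRange n (c + k)
  InRange-A (k≥1 , k≤a) = ≤-trans k≥1 (m≤n+m _ c) , ≤-trans (+-monoʳ-≤ c k≤a) (≤-trans c+a≤c+a+b c+a+b≤n)

  InRange-B : ∀ {m} → InRange b m → InRange n (c + a + m)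
  InRange-B (m≥1 , m≤b) = ≤-trans m≥1 (m≤n+m _ (c + a)) , ≤-trans (+-monoʳ-≤ (c + a) m≤b) c+a+b≤n

  corner-height : ∀ {h k} → IsShape h → Corner h k → InRange b (h k)
  corner-height g cr = corner-positive cr , bounded g _ (column≤a cr)

  inv-corner : ∀ {h k} → IsShape h → Corner h k → InjectiveOn n (perm (lower h k)) →
               inv n (perm (lower h k)) < inv n (perm h)
  inv-corner {h} {k} g cr inj = subst (inv n (perm h′) <_) (inv-cong n _ (perm h) (λ p _ → perm-raise g cr p))
    (inv-ascent n (perm h′) (letter h k) (c + k) (c + a + h k) inj (InRange-A (column cr)) (InRange-B hk∈b)
                A<B (trans (perm-A h′ k (column cr)) (aValue-lower-at cr))
                (trans (perm-B h′ (h k) hk∈b) (trans (bValue-lower-corner g cr) (sym (suc-letter-corner cr)))))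
    where
    h′ = lower h k
    hk∈b = corner-height g cr
    A<B : c + k < c + a + h k
    A<B = ≤-<-trans (+-monoʳ-≤ c (column≤a cr)) (m<m+n (c + a) (proj₁ hk∈b))

  run-represents : ∀ {h w κ} → IsShape h → Run h w κ → ∀ p → prod w p ≡ perm h p
  run-represents g (done dn) p = sym (perm-cleared g dn p)
  run-represents g (remove cr refl r) p = trans (cong (s _) (run-represents (lower-shape g cr) r p)) (perm-raise g cr p)

  run-isWord : ∀ {h w κ} → IsShape h → Run h w κ → IsWord n w
  run-isWord g (done _) = []
  run-isWord {h} g (remove {k = k} cr refl r) = (letter≥1 , letter<n) ∷ run-isWord (lower-shape g cr) r
    where
    suc-letter≡ : suc (letter h k) ≡ aValue h k
    suc-letter≡ = suc-letter-corner cr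
    letter≥1 : 1 ≤ letter h k
    letter≥1 = ≤-pred (≤-trans (m≤n+m 2 c) (subst (c + 2 ≤_) (sym suc-letter≡) (c+2≤aValue cr)))
    letter<n : letter h k < n
    letter<n = subst (_≤ n) (sym suc-letter≡) (≤-trans (aValue-≤ g k (column≤a cr)) c+a+b≤n)

  run-length≤inv : ∀ {h w κ} → IsShape h → Run h w κ → length w ≤ inv n (perm h)
  run-length≤inv g (done _) = z≤n
  run-length≤inv g (remove {w = w} cr refl r) = ≤-trans (s≤s (run-length≤inv g′ r)) (inv-corner g cr injective)
    where
    g′ = lower-shape g cr
    injective : InjectiveOn n (perm _)
    injective i j _ _ e = prod-injective w (trans (run-represents g′ r i) (trans e (sym (run-represents g′ r j))))

  word⇒run : ∀ {h} v → IsShape h → (∀ i → InRange n i → prod v i ≡ perm h i) → length v ≤ inv n (perm h) →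
             ∃[ κ ] Run h v κ
  word⇒run {h} [] g pr le = [] , done cleared
    where
    cleared : Cleared h
    cleared k ik = +-cancelˡ-≡ (c + k) (h k) 0
      (trans (sym (perm-A h k ik)) (trans (sym (pr (c + k) (InRange-A ik))) (sym (+-identityʳ (c + k)))))
  word⇒run {h} (x ∷ v) g pr le with inv-descent n (perm h) x decreases
    where
    decreases : inv n (s x ∘ perm h) < inv n (perm h)
    decreases =
      ≤-trans (s≤s (inv≤length n v _ (λ i ii → trans (sym (s-involutive x (prod v i))) (cong (s x) (pr i ii))))) le
  ... | p , q , _ , _ , p<q , ep , eq with descent⇒corner g p q x p<q ep eq
  ... | k , cr , refl with word⇒run v (lower-shape g cr) pr′ le′
    where
    pr′ : ∀ i → InRange n i → prod v i ≡ perm (lower h k) i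
    pr′ i ii = trans (sym (s-involutive (letter h k) (prod v i))) (trans (cong (s (letter h k)) (pr i ii)) (perm-lower g cr i))
    injective : InjectiveOn n (perm h)
    injective i j ii ij e = prod-injective (letter h k ∷ v) (trans (pr i ii) (trans e (sym (pr j ij))))
    le′ : length v ≤ inv n (perm (lower h k))
    le′ = ≤-pred (begin
      suc (length v)                   ≤⟨ le ⟩
      inv n (perm h)                   ≤⟨ inv≤inv∘s+1 n (perm h) (letter h k) injective ⟩
      inv n (s (letter h k) ∘ perm h) + 1 ≡⟨ cong (_+ 1) (inv-cong n _ _ (λ i _ → perm-lower g cr i)) ⟩
      inv n (perm (lower h k)) + 1     ≡⟨ +-comm _ 1 ⟩
      suc (inv n (perm (lower h k)))   ∎)
      where open ≤-Reasoning
  ... | κ , r = k ∷ κ , remove cr refl r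

  data RunWalk (h : ℕ → ℕ) : List ℕ → List ℕ → ℕ → Set where
    here : ∀ {u} → RunWalk h u u 0
    step : ∀ {u v w j} → Move u v → ∃[ κ ] Run h v κ → RunWalk h v w j → RunWalk h u w (suc j)

  runWalk-++ : ∀ {h u v w j k} → RunWalk h u v j → RunWalk h v w k → RunWalk h u w (j + k)
  runWalk-++ here W = W
  runWalk-++ (step mo r W₁) W = step mo r (runWalk-++ W₁ W)

  move-cons : ∀ x {u v} → Move u v → Move (x ∷ u) (x ∷ v)
  move-cons x (commute p q j k fr) = commute (x ∷ p) q j k fr
  move-cons x (braid₁ p q j) = braid₁ (x ∷ p) q j
  move-cons x (braid₂ p q j) = braid₂ (x ∷ p) q j

  runWalk-cons : ∀ {h k x u v j} → Corner h k → x ≡ letter h k →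
                 RunWalk (lower h k) u v j → RunWalk h (x ∷ u) (x ∷ v) j
  runWalk-cons cr e here = here
  runWalk-cons cr e (step mo (_ , r) W) = step (move-cons _ mo) (_ , remove cr e r) (runWalk-cons cr e W)

  cost : ℕ → ℕ → ℕ
  cost zero y = 0
  cost (suc x) y = y ∸ suc x + cost x y

  cost-suc : ∀ x y → x < suc y → cost x (suc y) ≡ cost x y + x
  cost-suc zero y _ = refl
  cost-suc (suc x) y (s≤s lt) = begin
    y ∸ x + cost x (suc y)            ≡⟨ cong₂ _+_ y∸x≡ (cost-suc x y (m<n⇒m<1+n lt)) ⟩
    suc (y ∸ suc x) + (cost x y + x)  ≡⟨ rearrange (y ∸ suc x) (cost x y) x ⟩
    y ∸ suc x + cost x y + suc x      ∎
    where
    open ≡-Reasoning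
    rearrange : ∀ A B x → suc A + (B + x) ≡ A + B + suc x
    rearrange = solve-∀
    y∸x≡ : y ∸ x ≡ suc (y ∸ suc x)
    y∸x≡ = trans (sym (suc[n∸1]≡n (m<n⇒0<n∸m lt))) (cong suc (trans (∸-+-assoc y x 1) (cong (y ∸_) (+-comm x 1))))

  pairCost : (ℕ → ℕ) → ℕ → ℕ → ℕ
  pairCost h i j = if i <ᵇ j then cost (h i) (h j) else 0

  potential : (ℕ → ℕ) → ℕ
  potential h = sumTo a (λ i → sumTo a (pairCost h i))

  saving : (ℕ → ℕ) → ℕ → ℕ → ℕ → ℕ
  saving h k i j = if (i ≡ᵇ k) ∧ (k <ᵇ j) then h j ∸ h k
                   else if (j ≡ᵇ k) ∧ (i <ᵇ k) then h i
                   else 0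

  totalSaving : (ℕ → ℕ) → ℕ → ℕ
  totalSaving h k = sumTo a (λ i → sumTo a (saving h k i))

  pairCost-lower : ∀ {h k} → IsShape h → Corner h k → ∀ i j →
                   pairCost (lower h k) i j + saving h k i j ≤ pairCost h i j
  pairCost-lower {h} {k} g cr i j with i <? j | i ≟ k | j ≟ k
  ... | no i≮j | yes refl | _
    rewrite ≮⇒<ᵇ-false i j i≮j | ≡ᵇ-refl i | ≮⇒<ᵇ-false i i (<-irrefl refl) with j ≡ᵇ i
  ...   | true = ≤-refl
  ...   | false = ≤-refl
  pairCost-lower g cr i j | no i≮j | no i≢k | yes refl
    rewrite ≮⇒<ᵇ-false i j i≮j | ≢⇒≡ᵇ-false i j i≢k | ≡ᵇ-refl j = ≤-refl
  pairCost-lower {k = k} g cr i j | no i≮j | no i≢k | no j≢k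
    rewrite ≮⇒<ᵇ-false i j i≮j | ≢⇒≡ᵇ-false i k i≢k | ≢⇒≡ᵇ-false j k j≢k = ≤-refl
  pairCost-lower g cr i j | yes i<j | yes refl | yes refl = ⊥-elim (<-irrefl refl i<j)
  pairCost-lower {h} g cr i j | yes i<j | yes refl | no j≢k
    rewrite <⇒<ᵇ-true i j i<j | ≡ᵇ-refl i | lower-elsewhere h i j j≢k =
    ≤-reflexive (dropFirst (h i) (corner-positive cr))
    where dropFirst : ∀ x → 1 ≤ x → cost (x ∸ 1) (h j) + (h j ∸ x) ≡ cost x (h j)
          dropFirst (suc x) _ = +-comm (cost x (h j)) (h j ∸ suc x)
  pairCost-lower {h} g cr i j | yes i<j | no i≢k | yes refl
    rewrite <⇒<ᵇ-true i j i<j | ≢⇒≡ᵇ-false i j i≢k | ≡ᵇ-refl j =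
    ≤-reflexive (sym (trans (cong (cost (h i)) (sym hj≡))
                            (cost-suc (h i) (h j ∸ 1) (subst (h i <_) (sym hj≡) (corner-strict g cr i i<j)))))
    where hj≡ : suc (h j ∸ 1) ≡ h j
          hj≡ = suc[n∸1]≡n (corner-positive cr)
  pairCost-lower {h} {k} g cr i j | yes i<j | no i≢k | no j≢k
    rewrite <⇒<ᵇ-true i j i<j | ≢⇒≡ᵇ-false i k i≢k | ≢⇒≡ᵇ-false j k j≢k =
    ≤-reflexive (+-identityʳ _)

  saving-lower : ∀ {h k k'} → k ≢ k' → ∀ i j → saving (lower h k') k i j ≤ saving h k i j
  saving-lower {h} {k} {k'} ne i j with (i ≡ᵇ k) ∧ (k <ᵇ j) | (j ≡ᵇ k) ∧ (i <ᵇ k)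
  ... | true | _ rewrite lower-elsewhere h k' k ne = ∸-monoˡ-≤ (h k) (lower-≤ h k' j)
  ... | false | true = lower-≤ h k' i
  ... | false | false = ≤-refl

  potential-lower : ∀ {h k} → IsShape h → Corner h k → potential (lower h k) + totalSaving h k ≤ potential h
  potential-lower {h} {k} g cr = subst (_≤ potential h) (sumTo²-distrib-+ a (pairCost (lower h k)) (saving h k))
    (sumTo-mono-≤ a (λ i _ → sumTo-mono-≤ a (λ j _ → pairCost-lower g cr i j)))

  totalSaving-lower : ∀ {h k k'} → IsShape h → Corner h k → Corner h k' → k ≢ k' →
                      totalSaving (lower h k') k < totalSaving h k
  totalSaving-lower {h} {k} {k'} g cr cr' ne with <-cmp k k'
  ... | tri≈ _ e _ = ⊥-elim (ne e)
  ... | tri< lt _ _ = sumTo-mono-< a (λ i _ → sumTo-mono-≤ a (λ j _ → saving-lower ne i j)) k (column cr)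
                        (sumTo-mono-< a (λ j _ → saving-lower ne k j) k' (column cr') strict)
    where
    strict : saving (lower h k') k k k' < saving h k k k'
    strict rewrite ≡ᵇ-refl k | <⇒<ᵇ-true k k' lt | lower-at h k' | lower-elsewhere h k' k ne =
      subst (_< h k' ∸ h k) (sym (∸-+-assoc (h k') 1 (h k))) (∸-monoʳ-< (n<1+n (h k)) (corner-strict g cr' k lt))
  ... | tri> _ _ gt = sumTo-mono-< a (λ i _ → sumTo-mono-≤ a (λ j _ → saving-lower ne i j)) k' (column cr')
                        (sumTo-mono-< a (λ j _ → saving-lower ne k' j) k (column cr) strict)
    where
    strict : saving (lower h k') k k' k < saving h k k' k
    strict rewrite ≢⇒≡ᵇ-false k' k (ne ∘ sym) | ≡ᵇ-refl k | <⇒<ᵇ-true k' k gt | lower-at h k' =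
      ≤-reflexive (suc[n∸1]≡n (corner-positive cr'))

  -- Corner k is brought to the front by one commutation past each corner removed before it;
  -- each of these removals strictly decreases totalSaving h k.
  bubble : ∀ {h k u κ} → IsShape h → Corner h k → Run h u κ →
           ∃[ u′ ] ∃[ κ′ ] ∃[ j ]
             (Run (lower h k) u′ κ′ × j ≤ totalSaving h k × RunWalk h u (letter h k ∷ u′) j)
  bubble g cr (done dn) = ⊥-elim (cleared⇒¬corner dn cr)
  bubble {h} {k} g cr (remove {k = k'} {w = u₀} {κ = κ₀} cr' refl r) with k' ≟ k
  ... | yes refl = u₀ , κ₀ , 0 , r , z≤n , here
  ... | no ne with bubble (lower-shape g cr') (corner-lower cr (ne ∘ sym)) r
  ... | u₁ , κ₁ , j , r₁ , j≤ , W =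
    letter h k' ∷ u₁ , k' ∷ κ₁ , j + 1 , r′ , bound ,
    runWalk-++ W′ (step swapFront (_ , remove cr refl r′) here)
    where
    r′ : Run (lower h k) (letter h k' ∷ u₁) (k' ∷ κ₁)
    r′ = remove (corner-lower cr' ne) (sym (letter-lower h k' k ne)) (Run-cong (lower-comm h k k' (ne ∘ sym)) r₁)
    W′ : RunWalk h (letter h k' ∷ u₀) (letter h k' ∷ letter h k ∷ u₁) j
    W′ = subst (λ t → RunWalk h (letter h k' ∷ u₀) (letter h k' ∷ t ∷ u₁) j) (letter-lower h k k' (ne ∘ sym))
               (runWalk-cons cr' refl W)
    swapFront : Move (letter h k' ∷ letter h k ∷ u₁) (letter h k ∷ letter h k' ∷ u₁)
    swapFront = commute [] u₁ (letter h k') (letter h k) (letters-far g cr' cr ne)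
    bound : j + 1 ≤ totalSaving h k
    bound = subst (_≤ totalSaving h k) (+-comm 1 j) (≤-<-trans j≤ (totalSaving-lower g cr cr' (ne ∘ sym)))

  runs-connected : ∀ {h u v κ κ'} → IsShape h → Run h u κ → Run h v κ' →
                   ∃[ j ] (j ≤ potential h × RunWalk h u v j)
  runs-connected g (done _) (done _) = 0 , z≤n , here
  runs-connected g (remove cr _ _) (done dn) = ⊥-elim (cleared⇒¬corner dn cr)
  runs-connected {h} g ru (remove {k = k} cr refl rv) with bubble g cr ru
  ... | u′ , _ , j₁ , ru′ , j₁≤ , W₁ with runs-connected (lower-shape g cr) ru′ rv
  ... | j₂ , j₂≤ , W₂ = j₁ + j₂ , bound , runWalk-++ W₁ (runWalk-cons cr refl W₂)
    where
    bound : j₁ + j₂ ≤ potential h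
    bound = ≤-trans (+-mono-≤ j₁≤ j₂≤)
                    (subst (_≤ potential h) (+-comm (potential (lower h k)) (totalSaving h k)) (potential-lower g cr))

  letter-lower₂ : ∀ h {k k₁ k₂} → k ≢ k₁ → k ≢ k₂ → letter (lower (lower h k₁) k₂) k ≡ letter h k
  letter-lower₂ h {k} {k₁} {k₂} ne₁ ne₂ = trans (letter-lower (lower h k₁) k k₂ ne₂) (letter-lower h k k₁ ne₁)

  commute⇒adjacentSwap : ∀ {h κ κ'} p q j k → Far j k → IsShape h →
                         Run h (p ++ j ∷ k ∷ q) κ → Run h (p ++ k ∷ j ∷ q) κ' → AdjacentSwap κ κ'
  commute⇒adjacentSwap (_ ∷ p) q j k fr g (remove {k = k₁} cr₁ e₁ r₁) (remove {k = k₂} cr₂ e₂ r₂)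
    with letter-injective g k₁ k₂ (column cr₁) (column cr₂) (trans (sym e₁) e₂)
  ... | refl with commute⇒adjacentSwap p q j k fr (lower-shape g cr₁) r₁ r₂
  ... | swap p′ x y q′ = swap (k₁ ∷ p′) x y q′
  commute⇒adjacentSwap {h} [] q j k fr g (remove {k = k₁} cr₁ refl (remove {k = k₂} cr₂ refl r))
                                          (remove {k = k₂′} cr₂′ e₂′ (remove {k = k₁′} cr₁′ e₁′ r′))
    with distinct
       | letter-injective g k₂ k₂′ (column cr₂) (column cr₂′)
                          (trans (sym (letter-lower h k₂ k₁ distinct)) e₂′)
    where
    distinct : k₂ ≢ k₁
    distinct refl = notFar fr
      where
      notFar : ¬ Far (letter h k₁) (letter (lower h k₁) k₁)
      notFar (inj₁ far) = <-asym far (m<n⇒m<1+n (subst (letter (lower h k₁) k₁ <_) (suc-letter-lower cr₁) (n<1+n _)))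
      notFar (inj₂ far) = <-irrefl (suc-letter-lower cr₁) far
  ... | k₂≢k₁ | refl
    with letter-injective (lower-shape g cr₂′) k₁ k₁′ (column cr₁) (column cr₁′)
                          (trans (letter-lower h k₁ k₂ (k₂≢k₁ ∘ sym)) e₁′)
  ... | refl = subst (λ t → AdjacentSwap (k₁ ∷ k₂ ∷ _) (k₂ ∷ k₁ ∷ t)) sameTail (swap [] k₁ k₂ _)
    where
    sameTail = run-unique (lower-shape (lower-shape g cr₂′) cr₁′) (Run-cong (lower-comm h k₂ k₁ k₂≢k₁) r) r′

  -- Removing the corner with letter j and then one with letter j + 1 forces the second corner to be
  -- the next column at the same height; the letter j is then no longer available.
  no-braid₁ : ∀ {h κ} p q j → IsShape h → Run h (p ++ j ∷ suc j ∷ j ∷ q) κ → ⊥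
  no-braid₁ (_ ∷ p) q j g (remove cr _ r) = no-braid₁ p q j (lower-shape g cr) r
  no-braid₁ {h} [] q j g (remove {k = k₁} cr₁ refl (remove {k = k₂} cr₂ e₂ (remove {k = k₃} cr₃ e₃ r)))
    with k₂ ≟ k₁
  ... | yes refl = m≢1+n+m (letter h k₁) (sym (trans (cong suc e₂) (suc-letter-lower cr₁)))
  ... | no k₂≢k₁
    with aValue-adjacent g k₁ k₂ (column cr₁) (column cr₂)
           (letter-suc⇒aValue-suc {h} {h} (column≥1 cr₁) (column≥1 cr₂)
                                 (trans (sym (letter-lower h k₂ k₁ k₂≢k₁)) (sym e₂)))
  ... | refl , level with k₃ ≟ k₁
  ...   | yes refl = 1+n≢n (trans (cong suc e₃)
                        (trans (cong suc (letter-lower (lower h k₃) k₃ (suc k₃) (k₂≢k₁ ∘ sym)))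
                               (suc-letter-lower cr₁)))
  ...   | no k₃≢k₁ with k₃ ≟ suc k₁
  ...     | yes refl = <-irrefl flat (rises cr₃)
    where
    h₁ = lower h k₁
    flat : lower h₁ (suc k₁) k₁ ≡ lower h₁ (suc k₁) (suc k₁)
    flat = begin
      lower h₁ (suc k₁) k₁        ≡⟨ lower-elsewhere h₁ (suc k₁) k₁ (k₂≢k₁ ∘ sym) ⟩
      h₁ k₁                       ≡⟨ lower-at h k₁ ⟩
      h k₁ ∸ 1                    ≡⟨ cong (_∸ 1) (sym level) ⟩
      h (suc k₁) ∸ 1              ≡⟨ cong (_∸ 1) (lower-elsewhere h k₁ (suc k₁) k₂≢k₁) ⟨
      h₁ (suc k₁) ∸ 1             ≡⟨ lower-at h₁ (suc k₁) ⟨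
      lower h₁ (suc k₁) (suc k₁)  ∎
      where open ≡-Reasoning
  ...     | no k₃≢k₂ = k₃≢k₁ (letter-injective g k₃ k₁ (column cr₃) (column cr₁)
                                (trans (sym (letter-lower₂ h k₃≢k₁ k₃≢k₂)) (sym e₃)))

  -- Here the first two corners must lie in the same column (otherwise column k₁ would not rise),
  -- and then the letter j + 1 is no longer available.
  no-braid₂ : ∀ {h κ} p q j → IsShape h → Run h (p ++ suc j ∷ j ∷ suc j ∷ q) κ → ⊥
  no-braid₂ (_ ∷ p) q j g (remove cr _ r) = no-braid₂ p q j (lower-shape g cr) r
  no-braid₂ {h} [] q j g (remove {k = k₁} cr₁ e₁ (remove {k = k₂} cr₂ e₂ (remove {k = k₃} cr₃ e₃ r)))
    with k₂ ≟ k₁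
  ... | no k₂≢k₁
    with aValue-adjacent g k₂ k₁ (column cr₂) (column cr₁)
           (letter-suc⇒aValue-suc {h} {h} (column≥1 cr₂) (column≥1 cr₁)
                                 (trans (sym e₁) (cong suc (trans e₂ (letter-lower h k₂ k₁ k₂≢k₁)))))
  ...   | refl , level = <-irrefl (sym level) (rises cr₁)
  no-braid₂ {h} [] q j g (remove {k = k₁} cr₁ e₁ (remove cr₂ e₂ (remove {k = k₃} cr₃ e₃ r))) | yes refl
    with k₃ ≟ k₁
  ... | yes refl = m≢1+n+m j (sym (trans (cong suc e₃) (trans (suc-letter-lower cr₂) (sym e₂))))
  ... | no k₃≢k₁ = k₃≢k₁ (letter-injective g k₃ k₁ (column cr₃) (column cr₁)
                            (trans (sym (letter-lower₂ h k₃≢k₁ k₃≢k₁)) (trans (sym e₃) e₁)))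

  invList-move : ∀ {h u v κ κ'} → IsShape h → Move u v → Run h u κ → Run h v κ' → invList κ ≤ invList κ' + 1
  invList-move g (commute p q j k fr) ru rv = invList-adjacentSwap (commute⇒adjacentSwap p q j k fr g ru rv)
  invList-move g (braid₁ p q j) ru rv = ⊥-elim (no-braid₁ p q j g ru)
  invList-move g (braid₂ p q j) ru rv = ⊥-elim (no-braid₂ p q j g ru)

  full : ℕ → ℕ
  full i = if i ≡ᵇ 0 then 0 else b

  full-pos : ∀ i → 1 ≤ i → full i ≡ b
  full-pos (suc i) _ = refl

  full-shape : IsShape full
  full-shape = record { at-0 = refl ; monotone = monotone′ ; bounded = bounded′ }
    where
    monotone′ : ∀ i j → i ≤ j → j ≤ a → full i ≤ full j
    monotone′ zero j _ _ = z≤n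
    monotone′ (suc i) (suc j) _ _ = ≤-refl
    bounded′ : ∀ i → i ≤ a → full i ≤ b
    bounded′ zero _ = z≤n
    bounded′ (suc i) _ = ≤-refl

  columnByColumn : ℕ → ℕ → List ℕ
  columnByColumn k zero = []
  columnByColumn k (suc m) = replicate b k ++ columnByColumn (suc k) m

  levelByLevel : ℕ → List ℕ
  levelByLevel zero = []
  levelByLevel (suc q) = interval 1 a ++ levelByLevel q

  lower-keeps-0 : ∀ h {k} → 1 ≤ k → h 0 ≡ 0 → lower h k 0 ≡ 0
  lower-keeps-0 h k≥1 h0 = trans (lower-elsewhere h _ 0 (<⇒≢ k≥1)) h0

  previous-empty : ∀ {h : ℕ → ℕ} k → h 0 ≡ 0 → (∀ i → 1 ≤ i → i < k → h i ≡ 0) → h (k ∸ 1) ≡ 0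
  previous-empty zero h0 _ = h0
  previous-empty (suc zero) h0 _ = h0
  previous-empty (suc (suc k)) _ empty = empty (suc k) (s≤s z≤n) ≤-refl

  mutual
    emptyColumns : ∀ m k h → h 0 ≡ 0 → 1 ≤ k → k + m ≡ suc a →
                   (∀ i → 1 ≤ i → i < k → h i ≡ 0) → (∀ i → k ≤ i → i ≤ a → h i ≡ b) →
                   ∃[ w ] Run h w (columnByColumn k m)
    emptyColumns zero k h _ _ e empty _ =
      [] , done (λ i (i≥1 , i≤a) → empty i i≥1 (subst (i <_) (trans (sym e) (+-identityʳ k)) (s≤s i≤a)))
    emptyColumns (suc m) k h h0 k≥1 e empty filled =
      emptyColumn m b k h h0 k≥1 k≤a (trans (sym (+-suc k m)) e) empty (filled k ≤-refl k≤a)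
                  (λ i k<i → filled i (<⇒≤ k<i))
      where k≤a : k ≤ a
            k≤a = ≤-pred (subst (suc k ≤_) e (subst (suc k ≤_) (sym (+-suc k m)) (s≤s (m≤m+n k m))))

    emptyColumn : ∀ m t k h → h 0 ≡ 0 → 1 ≤ k → k ≤ a → suc (k + m) ≡ suc a →
                  (∀ i → 1 ≤ i → i < k → h i ≡ 0) → h k ≡ t → (∀ i → k < i → i ≤ a → h i ≡ b) →
                  ∃[ w ] Run h w (replicate t k ++ columnByColumn (suc k) m)
    emptyColumn m zero k h h0 _ _ e empty hk filled = emptyColumns m (suc k) h h0 (s≤s z≤n) e empty′ filled
      where
      empty′ : ∀ i → 1 ≤ i → i < suc k → h i ≡ 0
      empty′ i i≥1 i<1+k with i ≟ k
      ... | yes refl = hk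
      ... | no i≢k = empty i i≥1 (≤∧≢⇒< (≤-pred i<1+k) i≢k)
    emptyColumn m (suc t) k h h0 k≥1 k≤a e empty hk filled
      with emptyColumn m t k (lower h k) (lower-keeps-0 h k≥1 h0) k≥1 k≤a e
             (λ i i≥1 i<k → trans (lower-elsewhere h k i (<⇒≢ i<k)) (empty i i≥1 i<k))
             (trans (lower-at h k) (cong (_∸ 1) hk))
             (λ i k<i i≤a → trans (lower-elsewhere h k i (>⇒≢ k<i)) (filled i k<i i≤a))
    ... | w , r = letter h k ∷ w , remove (corner (k≥1 , k≤a) rise) refl r
      where rise : h (k ∸ 1) < h k
            rise = subst₂ _<_ (sym (previous-empty k h0 empty)) (sym hk) (s≤s z≤n)

  step-up : ∀ t {h : ℕ → ℕ} {q} → h 0 ≡ 0 → (∀ i → 1 ≤ i → i ≤ t → h i ≡ q) →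
            h (suc t) ≡ suc q → h t < h (suc t)
  step-up zero h0 _ next = subst₂ _<_ (sym h0) (sym next) (s≤s z≤n)
  step-up (suc t) _ low next = subst₂ _<_ (sym (low (suc t) (s≤s z≤n) ≤-refl)) (sym next) (n<1+n _)

  <-of-+suc : ∀ {t l} → t + suc l ≡ a → t < a
  <-of-+suc {t} e = subst (t <_) e (m<m+n t (s≤s z≤n))

  lowerLevels : ∀ q l t h → h 0 ≡ 0 → t + l ≡ a →
                (∀ i → 1 ≤ i → i ≤ t → h i ≡ q) → (∀ i → t < i → i ≤ a → h i ≡ suc q) →
                ∃[ w ] Run h w (interval (suc t) l ++ levelByLevel q)
  lowerLevels zero zero t h _ e low _ =
    [] , done (λ i (i≥1 , i≤a) → low i i≥1 (subst (i ≤_) (trans (sym e) (+-identityʳ t)) i≤a))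
  lowerLevels (suc q) zero t h h0 e low _ =
    lowerLevels q a 0 h h0 refl (λ i i≥1 i≤0 → ⊥-elim (<⇒≱ i≥1 i≤0))
                (λ i i≥1 i≤a → low i i≥1 (subst (i ≤_) (trans (sym e) (+-identityʳ t)) i≤a))
  lowerLevels q (suc l) t h h0 e low high
    with lowerLevels q l (suc t) (lower h (suc t)) (lower-keeps-0 h {suc t} (s≤s z≤n) h0)
                     (trans (sym (+-suc t l)) e) low′ high′
    where
    t<a : t < a
    t<a = <-of-+suc e
    low′ : ∀ i → 1 ≤ i → i ≤ suc t → lower h (suc t) i ≡ q
    low′ i i≥1 i≤1+t with i ≟ suc t
    ... | yes refl = trans (lower-at h i) (cong (_∸ 1) (high i ≤-refl t<a))
    ... | no i≢1+t = trans (lower-elsewhere h (suc t) i i≢1+t) (low i i≥1 (≤-pred (≤∧≢⇒< i≤1+t i≢1+t)))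
    high′ : ∀ i → suc t < i → i ≤ a → lower h (suc t) i ≡ suc q
    high′ i 1+t<i i≤a = trans (lower-elsewhere h (suc t) i (>⇒≢ 1+t<i)) (high i (<⇒≤ 1+t<i) i≤a)
  ... | w , r = letter h (suc t) ∷ w , remove (corner (s≤s z≤n , t<a) rise) refl r
    where
    t<a : t < a
    t<a = <-of-+suc e
    rise : h t < h (suc t)
    rise = step-up t h0 low (high (suc t) ≤-refl t<a)

  columnByColumn-run : ∃[ w ] Run full w (columnByColumn 1 a)
  columnByColumn-run = emptyColumns a 1 full refl ≤-refl refl
    (λ i i≥1 i<1 → ⊥-elim (<⇒≱ i≥1 (≤-pred i<1))) (λ i i≥1 _ → full-pos i i≥1)

  levelByLevel-run : 1 ≤ b → ∃[ w ] Run full w (levelByLevel b)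
  levelByLevel-run b≥1 = subst (λ t → ∃[ w ] Run full w (levelByLevel t)) (suc[n∸1]≡n b≥1)
    (lowerLevels (b ∸ 1) a 0 full refl refl (λ i i≥1 i≤0 → ⊥-elim (<⇒≱ i≥1 i≤0))
                 (λ i i≥1 _ → trans (full-pos i i≥1) (sym (suc[n∸1]≡n b≥1))))

  cost-diagonal : ∀ x → cost x x ≡ choose2 x
  cost-diagonal zero = refl
  cost-diagonal (suc x) rewrite n∸n≡0 x | cost-suc x x ≤-refl | cost-diagonal x = +-comm (choose2 x) x

  potential-full : potential full ≡ choose2 a * choose2 b
  potential-full = begin
    potential full
      ≡⟨ sumTo-cong a (λ i ii → sumTo-cong a (λ j ij → fullPair i j ii ij)) ⟩
    sumTo a (λ i → sumTo a (λ j → bit (i <ᵇ j) * cost b b))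
      ≡⟨ sumTo-cong a (λ i _ → sumTo-* a (λ j → bit (i <ᵇ j)) (cost b b)) ⟩
    sumTo a (λ i → sumTo a (λ j → bit (i <ᵇ j)) * cost b b)
      ≡⟨ sumTo-* a _ (cost b b) ⟩
    sumTo a (λ i → sumTo a (λ j → bit (i <ᵇ j))) * cost b b
      ≡⟨ cong₂ _*_ (trans (sumTo-swap a a (λ i j → bit (i <ᵇ j))) (orderedPairs a)) (cost-diagonal b) ⟩
    choose2 a * choose2 b
      ∎
    where
    open ≡-Reasoning
    fullPair : ∀ i j → InRange a i → InRange a j → pairCost full i j ≡ bit (i <ᵇ j) * cost b b
    fullPair i j ii ij rewrite full-pos i (proj₁ ii) | full-pos j (proj₁ ij) with i <ᵇ j
    ... | true = sym (+-identityʳ (cost b b))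
    ... | false = refl

  invList-replicate : ∀ k t {ys} → All (k ≤_) ys → invList ys ≡ 0 → invList (replicate t k ++ ys) ≡ 0
  invList-replicate k zero _ e = e
  invList-replicate k (suc t) {ys} p e
    rewrite countLess-none k (++⁺ (replicate⁺ t (≤-refl {k})) p) = invList-replicate k t p e

  All-≤-columnByColumn : ∀ {x} k m → x ≤ k → All (x ≤_) (columnByColumn k m)
  All-≤-columnByColumn k zero _ = []
  All-≤-columnByColumn k (suc m) p = ++⁺ (replicate⁺ b p) (All-≤-columnByColumn (suc k) m (m≤n⇒m≤1+n p))

  invList-columnByColumn : ∀ k m → invList (columnByColumn k m) ≡ 0
  invList-columnByColumn k zero = refl
  invList-columnByColumn k (suc m) =
    invList-replicate k b (All-≤-columnByColumn (suc k) m (n≤1+n k)) (invList-columnByColumn (suc k) m)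

  crossLess-levelByLevel : ∀ q → crossLess (interval 1 a) (levelByLevel q) ≡ q * choose2 a
  crossLess-levelByLevel zero = trans (sumMap-const 0 (interval 1 a)) (*-zeroʳ (length (interval 1 a)))
  crossLess-levelByLevel (suc q) = begin
    sumMap (λ x → countLess x (interval 1 a ++ levelByLevel q)) (interval 1 a)
      ≡⟨ sumMap-cong _ _ (All.universal (λ x → sumMap-++ (λ y → bit (y <ᵇ x)) (interval 1 a) (levelByLevel q))
                                        (interval 1 a)) ⟩
    sumMap (λ x → countLess x (interval 1 a) + countLess x (levelByLevel q)) (interval 1 a)
      ≡⟨ sumMap-distrib-+ _ _ (interval 1 a) ⟩
    crossLess (interval 1 a) (interval 1 a) + crossLess (interval 1 a) (levelByLevel q)
      ≡⟨ cong₂ _+_ (crossLess-interval a) (crossLess-levelByLevel q) ⟩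
    choose2 a + q * choose2 a
      ∎
    where open ≡-Reasoning

  invList-levelByLevel : ∀ q → invList (levelByLevel q) ≡ choose2 q * choose2 a
  invList-levelByLevel zero = refl
  invList-levelByLevel (suc q)
    rewrite invList-++ (interval 1 a) (levelByLevel q) | invList-interval 1 a
          | invList-levelByLevel q | crossLess-levelByLevel q =
    trans (+-comm (choose2 q * choose2 a) (q * choose2 a)) (sym (*-distribʳ-+ (choose2 a) q (choose2 q)))

  π : ℕ → ℕ
  π = piABCD a b c d

  countBelow-full : ∀ m → m ≤ b → countBelow full m ≡ 0
  countBelow-full m m≤b = sumTo-zero a (λ j (j≥1 , _) → none j j≥1)
    where none : ∀ j → 1 ≤ j → bit (full j <ᵇ m) ≡ 0
          none j j≥1 rewrite full-pos j j≥1 | ≮⇒<ᵇ-false b m (≤⇒≯ m≤b) = refl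

  π≡perm-full : ∀ p → π p ≡ perm full p
  π≡perm-full p with p ≤? c
  ... | yes p≤c rewrite ≤⇒≤ᵇ-true p c p≤c = refl
  ... | no p≰c with p ≤? c + a
  ... | yes p≤c+a rewrite ≰⇒≤ᵇ-false p c p≰c | ≤⇒≤ᵇ-true p (c + a) p≤c+a =
    cong (p +_) (sym (full-pos (p ∸ c) (m<n⇒0<n∸m (≰⇒> p≰c))))
  ... | no p≰c+a with p ≤? c + a + b
  ... | yes p≤c+a+b
    rewrite ≰⇒≤ᵇ-false p c p≰c | ≰⇒≤ᵇ-false p (c + a) p≰c+a | ≤⇒≤ᵇ-true p (c + a + b) p≤c+a+b =
    sym (trans (cong (p ∸ a +_) (countBelow-full (p ∸ (c + a))
                  (subst (p ∸ (c + a) ≤_) (m+n∸m≡n (c + a) b) (∸-monoˡ-≤ (c + a) p≤c+a+b))))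
               (+-identityʳ _))
  ... | no p≰c+a+b
    rewrite ≰⇒≤ᵇ-false p c p≰c | ≰⇒≤ᵇ-false p (c + a) p≰c+a | ≰⇒≤ᵇ-false p (c + a + b) p≰c+a+b = refl

  represents-π : ∀ {u κ} → Run full u κ → ∀ i → prod u i ≡ π i
  represents-π r i = trans (run-represents full-shape r i) (sym (π≡perm-full i))

  run⇒reduced : ∀ {u κ} → Run full u κ → Reduced n π u
  run⇒reduced {u} r = (run-isWord full-shape r , λ i _ _ → represents-π r i) , shortest
    where
    shortest : ∀ v → Represents n π v → length u ≤ length v
    shortest v (_ , pv) = ≤-trans (run-length≤inv full-shape r)
      (≤-trans (≤-reflexive (inv-cong n (perm full) π (λ i _ → sym (π≡perm-full i))))
               (inv≤length n v π (λ i (i≥1 , i≤n) → pv i i≥1 i≤n)))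

  reduced⇒run : ∀ {u} → Reduced n π u → ∃[ κ ] Run full u κ
  reduced⇒run {u} ((_ , pu) , shortest) =
    word⇒run u full-shape (λ i (i≥1 , i≤n) → trans (pu i i≥1 i≤n) (π≡perm-full i))
      (≤-trans (shortest w (run-isWord full-shape r , λ i _ _ → represents-π r i)) (run-length≤inv full-shape r))
    where
    w = proj₁ columnByColumn-run
    r = proj₂ columnByColumn-run

  runWalk⇒walk : ∀ {u v j} → RunWalk full u v j → Walk n π u v j
  runWalk⇒walk here = here
  runWalk⇒walk (step mo (_ , r) W) = step mo (run⇒reduced r) (runWalk⇒walk W)

  distance≤potential : ∀ u v → Reduced n π u → Reduced n π v → ∃[ k ] (k ≤ potential full × Walk n π u v k)
  distance≤potential u v ru rv with reduced⇒run ru | reduced⇒run rv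
  ... | _ , r | _ , r′ with runs-connected full-shape r r′
  ... | j , j≤ , W = j , j≤ , runWalk⇒walk W

  invList-walk : ∀ {u v k κ κ'} → Walk n π u v k → Run full u κ → Run full v κ' → invList κ ≤ invList κ' + k
  invList-walk here ru rv = ≤-trans (≤-reflexive (cong invList (run-unique full-shape ru rv))) (m≤m+n _ 0)
  invList-walk {k = suc k} {κ} {κ'} (step mo red W) ru rv with reduced⇒run red
  ... | κ₁ , r₁ = begin
    invList κ                   ≤⟨ invList-move full-shape mo ru r₁ ⟩
    invList κ₁ + 1              ≤⟨ +-monoˡ-≤ 1 (invList-walk W r₁ rv) ⟩
    invList κ' + k + 1          ≡⟨ +-assoc (invList κ') k 1 ⟩
    invList κ' + (k + 1)        ≡⟨ cong (invList κ' +_) (+-comm k 1) ⟩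
    invList κ' + suc k          ∎
    where open ≤-Reasoning

  diameter : 1 ≤ b → IsDiameter n π (potential full)
  diameter b≥1 = distance≤potential , u , v , run⇒reduced ru , run⇒reduced rv , farApart
    where
    u = proj₁ (levelByLevel-run b≥1)
    ru = proj₂ (levelByLevel-run b≥1)
    v = proj₁ columnByColumn-run
    rv = proj₂ columnByColumn-run
    farApart : ∀ k → Walk n π u v k → potential full ≤ k
    farApart k W = begin
      potential full                       ≡⟨ potential-full ⟩
      choose2 a * choose2 b                ≡⟨ *-comm (choose2 a) (choose2 b) ⟩
      choose2 b * choose2 a                ≡⟨ invList-levelByLevel b ⟨
      invList (levelByLevel b)             ≤⟨ invList-walk W ru rv ⟩
      invList (columnByColumn 1 a) + k     ≡⟨ cong (_+ k) (invList-columnByColumn 1 a) ⟩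
      k                                    ∎
      where open ≤-Reasoning

  InA InB : ℕ → Set
  InA i = c < i × i ≤ c + a
  InB j = c + a < j × j ≤ c + a + b

  π-inversion : ∀ {i j} → i < j → π j < π i → InA i × InB j
  π-inversion {i} {j} i<j πj<πi with perm-inversion full-shape i<j (subst₂ _<_ (π≡perm-full j) (π≡perm-full i) πj<πi)
  ... | k , m , (k≥1 , k≤a) , (m≥1 , m≤b) , refl , refl =
    (c<c+k k≥1 , +-monoʳ-≤ c k≤a) , (m<m+n (c + a) m≥1 , +-monoʳ-≤ (c + a) m≤b)

  AB⇒π-inversion : ∀ {i j} → InA i → InB j → i < j × π j < π i
  AB⇒π-inversion {i} {j} (c<i , i≤c+a) (c+a<j , j≤c+a+b) with block i | block j
  ... | inA k ik@(k≥1 , _) refl | inB m im@(_ , m≤b) refl = ≤-<-trans i≤c+a c+a<j , (begin-strict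
    π (c + a + m)   ≡⟨ trans (π≡perm-full (c + a + m)) (perm-B full m im) ⟩
    c + m + countBelow full m ≡⟨ cong (c + m +_) (countBelow-full m m≤b) ⟩
    c + m + 0       ≡⟨ +-identityʳ (c + m) ⟩
    c + m           ≤⟨ +-monoʳ-≤ c m≤b ⟩
    c + b           <⟨ +-monoʳ-< c (m<n+m b k≥1) ⟩
    c + (k + b)     ≡⟨ +-assoc c k b ⟨
    c + k + b       ≡⟨ trans (π≡perm-full (c + k)) (trans (perm-A full k ik) (cong (c + k +_) (full-pos k k≥1))) ⟨
    π (c + k)       ∎)
    where open ≤-Reasoning
  ... | inC i≤c | _ = ⊥-elim (<⇒≱ c<i i≤c)
  ... | inB _ (m≥1 , _) refl | _ = ⊥-elim (<⇒≱ (m<m+n (c + a) m≥1) i≤c+a)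
  ... | inD c+a+b<i | _ = ⊥-elim (<⇒≱ (≤-<-trans c+a≤c+a+b c+a+b<i) i≤c+a)
  ... | _ | inC j≤c = ⊥-elim (<⇒≱ (≤-<-trans (m≤m+n c a) c+a<j) j≤c)
  ... | _ | inA k (_ , k≤a) refl = ⊥-elim (<⇒≱ c+a<j (+-monoʳ-≤ c k≤a))
  ... | _ | inD c+a+b<j = ⊥-elim (<⇒≱ c+a+b<j j≤c+a+b)

  isInversionᵇ : ℕ → ℕ → Bool
  isInversionᵇ i j = (i <ᵇ j) ∧ (π j <ᵇ π i)

  isInversionᵇ-false : ∀ i j → ¬ (InA i × InB j) → isInversionᵇ i j ≡ false
  isInversionᵇ-false i j notAB with i <? j | π j <? π i
  ... | yes i<j | yes πj<πi = ⊥-elim (notAB (π-inversion i<j πj<πi))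
  ... | yes i<j | no πj≮πi rewrite <⇒<ᵇ-true i j i<j | ≮⇒<ᵇ-false (π j) (π i) πj≮πi = refl
  ... | no i≮j | _ rewrite ≮⇒<ᵇ-false i j i≮j = refl

  isInversionᵇ-true : ∀ i j → InA i → InB j → isInversionᵇ i j ≡ true
  isInversionᵇ-true i j ia jb
    rewrite <⇒<ᵇ-true i j (proj₁ (AB⇒π-inversion ia jb))
          | <⇒<ᵇ-true (π j) (π i) (proj₂ (AB⇒π-inversion ia jb)) = refl

  -- Two inversions (i , j) and (j , k) would put j both among the A- and among the B-positions.
  I3≡0 : I3 n π ≡ 0
  I3≡0 = cong length (concatMap-nil _ (All.universal (λ i → concatMap-nil _ (All.universal (λ j →
           concatMap-nil _ (All.universal (no321 i j) (positions n))) (positions n))) (positions n)))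
    where
    no321 : ∀ i j k →
            (if (i <ᵇ j) ∧ (j <ᵇ k) ∧ (π j <ᵇ π i) ∧ (π k <ᵇ π j) then (i , j , k) ∷ [] else []) ≡ []
    no321 i j k with i <? j | j <? k | π j <? π i | π k <? π j
    ... | yes i<j | yes j<k | yes πj<πi | yes πk<πj =
      ⊥-elim (<⇒≱ (proj₁ (proj₂ (π-inversion i<j πj<πi))) (proj₂ (proj₁ (π-inversion j<k πk<πj))))
    ... | no i≮j | _ | _ | _ rewrite ≮⇒<ᵇ-false i j i≮j = refl
    ... | yes i<j | no j≮k | _ | _ rewrite <⇒<ᵇ-true i j i<j | ≮⇒<ᵇ-false j k j≮k = refl
    ... | yes i<j | yes j<k | no πj≮πi | _
      rewrite <⇒<ᵇ-true i j i<j | <⇒<ᵇ-true j k j<k | ≮⇒<ᵇ-false (π j) (π i) πj≮πi = refl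
    ... | yes i<j | yes j<k | yes πj<πi | no πk≮πj
      rewrite <⇒<ᵇ-true i j i<j | <⇒<ᵇ-true j k j<k | <⇒<ᵇ-true (π j) (π i) πj<πi
            | ≮⇒<ᵇ-false (π k) (π j) πk≮πj = refl

  bPositions : List ℕ
  bPositions = interval (suc (c + a)) b

  inversionAt : ℕ → ℕ → List (ℕ × ℕ)
  inversionAt i j = if isInversionᵇ i j then (i , j) ∷ [] else []

  inversionsFrom : ℕ → List (ℕ × ℕ)
  inversionsFrom i = concatMap (inversionAt i) (interval 1 n)

  positions-AB : interval 1 n ≡ interval 1 c ++ interval (suc c) a ++ interval (suc (c + a)) (b + d)
  positions-AB = trans (cong (interval 1) (rearrange a b c d))
                       (trans (interval-++ 1 c (a + (b + d))) (cong (interval 1 c ++_) (interval-++ (suc c) a (b + d))))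
    where rearrange : ∀ a b c d → a + b + c + d ≡ c + (a + (b + d))
          rearrange = solve-∀

  positions-B : interval 1 n ≡ interval 1 (c + a) ++ bPositions ++ interval (suc (c + a + b)) d
  positions-B = trans (cong (interval 1) (rearrange a b c d))
                      (trans (interval-++ 1 (c + a) (b + d)) (cong (interval 1 (c + a) ++_) (interval-++ (suc (c + a)) b d)))
    where rearrange : ∀ a b c d → a + b + c + d ≡ c + a + (b + d)
          rearrange = solve-∀

  inversionsFrom-notA : ∀ i → ¬ InA i → inversionsFrom i ≡ []
  inversionsFrom-notA i notA = concatMap-nil _ (All.universal (λ j →
    cong (λ t → if t then (i , j) ∷ [] else []) (isInversionᵇ-false i j (notA ∘ proj₁))) (interval 1 n))

  inversionsFrom-A : ∀ i → InA i → inversionsFrom i ≡ row i bPositions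
  inversionsFrom-A i ia = begin
    inversionsFrom i
      ≡⟨ cong (concatMap (inversionAt i)) positions-B ⟩
    concatMap (inversionAt i) (interval 1 (c + a) ++ bPositions ++ interval (suc (c + a + b)) d)
      ≡⟨ concatMap-window (inversionAt i) (λ j → (i , j) ∷ [])
           (All-interval 1 (c + a) (λ j _ j≤ → notB j (λ jb → <⇒≱ (proj₁ jb) (≤-pred j≤))))
           (All-interval (suc (c + a)) b (λ j lo≤j j≤ → picked j (lo≤j , ≤-pred j≤)))
           (All-interval (suc (c + a + b)) d (λ j lo≤j _ → notB j (λ jb → <⇒≱ lo≤j (proj₂ jb)))) ⟩
    concatMap (λ j → (i , j) ∷ []) bPositions
      ≡⟨ concatMap-singleton _ (i ,_) (All.universal (λ _ → refl) bPositions) ⟩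
    row i bPositions
      ∎
    where
    open ≡-Reasoning
    notB : ∀ j → ¬ InB j → inversionAt i j ≡ []
    notB j nb = cong (λ t → if t then (i , j) ∷ [] else []) (isInversionᵇ-false i j (nb ∘ proj₂))
    picked : ∀ j → InB j → inversionAt i j ≡ (i , j) ∷ []
    picked j jb = cong (λ t → if t then (i , j) ∷ [] else []) (isInversionᵇ-true i j ia jb)

  inversions-π : inversions n π ≡ rows (suc c) a bPositions
  inversions-π = begin
    inversions n π
      ≡⟨ cong (λ ps → concatMap (λ i → concatMap (inversionAt i) ps) ps) (positions-interval n) ⟩
    concatMap inversionsFrom (interval 1 n)
      ≡⟨ cong (concatMap inversionsFrom) positions-AB ⟩
    concatMap inversionsFrom (interval 1 c ++ interval (suc c) a ++ interval (suc (c + a)) (b + d))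
      ≡⟨ concatMap-window inversionsFrom (λ i → row i bPositions)
           (All-interval 1 c (λ i _ i≤ → inversionsFrom-notA i (λ ia → <⇒≱ (proj₁ ia) (≤-pred i≤))))
           (All-interval (suc c) a (λ i lo≤i i≤ → inversionsFrom-A i (lo≤i , ≤-pred i≤)))
           (All-interval (suc (c + a)) (b + d) (λ i lo≤i _ → inversionsFrom-notA i (λ ia → <⇒≱ lo≤i (proj₂ ia)))) ⟩
    rows (suc c) a bPositions
      ∎
    where open ≡-Reasoning

  I2≡ : I2 n π ≡ choose2 a * (b * (b ∸ 1))
  I2≡ = trans (cong disjointPairs inversions-π) (disjointPairs-rows (suc c) a (suc (c + a)) b ≤-refl)

  2*potential-full≡L2 : 2 * potential full ≡ L2 n π
  2*potential-full≡L2 = begin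
    2 * potential full           ≡⟨ cong (2 *_) potential-full ⟩
    2 * (choose2 a * choose2 b)  ≡⟨ rearrange (choose2 a) (choose2 b) ⟩
    choose2 a * (2 * choose2 b)  ≡⟨ cong (choose2 a *_) (2*choose2 b) ⟩
    choose2 a * (b * (b ∸ 1))    ≡⟨ I2≡ ⟨
    I2 n π                       ≡⟨ +-identityʳ (I2 n π) ⟨
    I2 n π + 0                   ≡⟨ cong (I2 n π +_) I3≡0 ⟨
    L2 n π                       ∎
    where
    open ≡-Reasoning
    rearrange : ∀ x y → 2 * (x * y) ≡ x * (2 * y)
    rearrange = solve-∀

theorem6p10 : (a b c d : ℕ) → 2 ≤ a → 2 ≤ b →
    ∃[ D ] (IsDiameter (a + b + c + d) (piABCD a b c d) D
            × 2 * D ≡ L2 (a + b + c + d) (piABCD a b c d))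
theorem6p10 a b c d _ 2≤b = potential full , diameter (≤-trans (s≤s z≤n) 2≤b) , 2*potential-full≡L2
  where open Fillings a b c d
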